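{- Let $\mathcal C_n$ be the set of permutations in $\mathfrak S_n$ avoiding the generalized patterns $2\text{ - }1\text{ - }3$ and $32\text{ - }1$, and let $N(t,u,v)=\sum_{n\ge1}\sum_{\pi\in\mathcal C_n}u^{h(\pi)}v^{\pi_n}t^n$. Then $$N(t,u,v)=\frac{tv(1-t+tu-tuv)}{(1-tv)(1-t-tuv)}.$$
   Context: $\mathfrak S_n$ is the set of permutations $\pi=\pi_1\cdots\pi_n$ of $\{1,\dots,n\}$. $\pi$ avoids $2\text{ - }1\text{ - }3$ if there are no $i<j<k$ with $\pi_j<\pi_i<\pi_k$; $\pi$ avoids $32\text{ - }1$ if there are no $i$ and $k>i+1$ with $\pi_k<\pi_{i+1}<\pi_i$. For $\pi\in\mathfrak S_n$, $h(\pi)=0$ if $\pi=12\cdots n$, and otherwise $h(\pi)=\max\{\pi_i: i>1,\ \pi_{i-1}>\pi_i\}$. -}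

module Defs where

open import Data.Nat as ℕ using (ℕ; zero; suc; _⊔_)
open import Data.Integer as ℤ using (ℤ; +_; _+_; _*_; _-_)
open import Data.Fin as Fin using (Fin; toℕ; fromℕ)
open import Data.Fin.Properties using (all?; any?)
open import Data.Vec using (Vec; []; _∷_; lookup)
open import Data.List as List using (List; []; _∷_; length; filter; concatMap; map; allFin; foldr)
open import Data.Product using (∃; Σ; _×_; _,_)
open import Relation.Binary.PropositionalEquality using (_≡_)
open import Relation.Nullary using (¬_; Dec; yes; no; ¬?)
open import Relation.Nullary.Decidable using (_×-dec_; _→-dec_)

-- Position i : Fin n is the
-- (toℕ i + 1)-th position, and the entry x : Fin n stands for the value
-- toℕ x + 1.  (Comparisons of entries via Fin's _<_ agree with the
-- comparisons of the values.)

Word : ℕ → Set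
Word n = Vec (Fin n) n

words : (n k : ℕ) → List (Vec (Fin n) k)
words n zero    = [] ∷ []
words n (suc k) = concatMap (λ x → map (x ∷_) (words n k)) (allFin n)

IsPerm : ∀ {n} → Word n → Set
IsPerm π = ∀ i j → lookup π i ≡ lookup π j → i ≡ j

Contains213 : ∀ {n} → Word n → Set
Contains213 {n} π = ∃ λ (i : Fin n) → ∃ λ (j : Fin n) → ∃ λ (k : Fin n) →
  (i Fin.< j) × (j Fin.< k) × (lookup π j Fin.< lookup π i) × (lookup π i Fin.< lookup π k)

Contains32-1 : ∀ {n} → Word n → Set
Contains32-1 {n} π = ∃ λ (i : Fin n) → ∃ λ (j : Fin n) → ∃ λ (k : Fin n) →
  (toℕ j ≡ suc (toℕ i)) × (j Fin.< k) × (lookup π k Fin.< lookup π j) × (lookup π j Fin.< lookup π i)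

InC : ∀ {n} → Word n → Set
InC π = IsPerm π × ¬ Contains213 π × ¬ Contains32-1 π

IsIdentity : ∀ {n} → Word n → Set
IsIdentity {n} π = ∀ (i : Fin n) → lookup π i ≡ i

-- h(π) = 0 if π = 12⋯n, otherwise max { π_i : i > 1, π_{i-1} > π_i }
-- (the list below collects the values π_i over all descent bottoms i)
descentBottoms : ∀ {n} → Word n → List ℕ
descentBottoms {n} π =
  concatMap (λ i → concatMap (λ j → bottom i j) (allFin n)) (allFin n)
  where
  bottom : Fin n → Fin n → List ℕ
  bottom i j with toℕ j ℕ.≟ suc (toℕ i) | lookup π j Fin.<? lookup π i
  ... | yes _ | yes _ = suc (toℕ (lookup π j)) ∷ []
  ... | _     | _     = []

h : ∀ {n} → Word n → ℕ
h π with all? (λ i → lookup π i Fin.≟ i)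
... | yes _ = 0
... | no  _ = foldr _⊔_ 0 (descentBottoms π)

isPerm? : ∀ {n} (π : Word n) → Dec (IsPerm π)
isPerm? π = all? (λ i → all? (λ j → (lookup π i Fin.≟ lookup π j) →-dec (i Fin.≟ j)))

contains213? : ∀ {n} (π : Word n) → Dec (Contains213 π)
contains213? π = any? λ i → any? λ j → any? λ k →
  (i Fin.<? j) ×-dec (j Fin.<? k) ×-dec (lookup π j Fin.<? lookup π i) ×-dec (lookup π i Fin.<? lookup π k)

contains32-1? : ∀ {n} (π : Word n) → Dec (Contains32-1 π)
contains32-1? π = any? λ i → any? λ j → any? λ k →
  (toℕ j ℕ.≟ suc (toℕ i)) ×-dec (j Fin.<? k) ×-dec (lookup π k Fin.<? lookup π j) ×-dec (lookup π j Fin.<? lookup π i)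

inC? : ∀ {n} (π : Word n) → Dec (InC π)
inC? π = isPerm? π ×-dec ¬? (contains213? π) ×-dec ¬? (contains32-1? π)

lastValue : ∀ {m} → Word (suc m) → ℕ
lastValue {m} π = suc (toℕ (lookup π (fromℕ m)))

Counted : ∀ {m} → ℕ → ℕ → Word (suc m) → Set
Counted a b π = InC π × (h π ≡ a) × (lastValue π ≡ b)

counted? : ∀ {m} a b (π : Word (suc m)) → Dec (Counted a b π)
counted? a b π = inC? π ×-dec (h π ℕ.≟ a) ×-dec (lastValue π ℕ.≟ b)

-- Formal power series in t, u, v with integer coefficients:
-- S n a b = coefficient of t^n u^a v^b.

Series : Set
Series = ℕ → ℕ → ℕ → ℤ

Σ≤ : ℕ → (ℕ → ℤ) → ℤ
Σ≤ zero    f = f 0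
Σ≤ (suc n) f = Σ≤ n f + f (suc n)

_⊕_ : Series → Series → Series
(f ⊕ g) n a b = f n a b + g n a b

_⊖_ : Series → Series → Series
(f ⊖ g) n a b = f n a b - g n a b

_⊛_ : Series → Series → Series
(f ⊛ g) n a b =
  Σ≤ n λ n₁ → Σ≤ a λ a₁ → Σ≤ b λ b₁ →
    f n₁ a₁ b₁ * g (n ℕ.∸ n₁) (a ℕ.∸ a₁) (b ℕ.∸ b₁)

infixl 6 _⊕_ _⊖_
infixl 7 _⊛_

mono : ℕ → ℕ → ℕ → Series
mono i j k n a b with n ℕ.≟ i | a ℕ.≟ j | b ℕ.≟ k
... | yes _ | yes _ | yes _ = + 1
... | _     | _     | _     = + 0

𝟙 t u v : Series
𝟙 = mono 0 0 0
t = mono 1 0 0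
u = mono 0 1 0
v = mono 0 0 1

N : Series
N zero    a b = + 0
N (suc m) a b = + length (filter (counted? a b) (words (suc m) (suc m)))

module Submission where

open import Defs
open import Relation.Binary.PropositionalEquality using (_≡_)

-- Every π ∈ 𝒞ₙ₊₁ arises from a unique σ ∈ 𝒞ₙ by prepending a new first
-- letter x (the letters ≥ x of σ move up by one), and exactly two letters x are admissible:
-- x = 1, and x = σ₁ (or the new top letter n+1 when σ₁ = 1).  The first raises every descent
-- bottom, hence h (unless h = 0), and the last letter by one; the second adds the descent bottom
-- 1 or none, so h becomes max(h,1), and keeps the last letter.  This yields a recurrence for the
-- numbers  count m a b = #{π ∈ 𝒞ₘ₊₁ : h π = a, πₘ₊₁ = b}.
--
-- Multiplying N by the denominator one factor at a time, the recurrence turns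
-- N (1 - t - tuv) into an explicit series NB (all its coefficients of u^a, a ≥ 2, vanish), and
-- NB (1 - tv) is the numerator.

module Counting where

  open import Data.Nat using (ℕ; zero; suc; _+_; _*_; _≟_)
  open import Data.Nat.Properties using (+-assoc; +-commutativeSemigroup; +-0-commutativeMonoid)
  open import Data.Fin using (Fin; punchIn)
  open import Data.Vec using (Vec; _∷_; lookup)
  import Data.Vec as Vec
  open import Data.List using (List; []; _∷_; _++_; length; filter; map; concatMap; tabulate; allFin)
  open import Data.Bool using (true; false; if_then_else_)
  open import Data.Product using (∃; _,_)
  open import Data.Empty using (⊥-elim)
  open import Function using (_∘_; id)
  open import Level using (0ℓ)
  open import Relation.Nullary using (¬_; Dec; does; yes; no)
  open import Relation.Nullary.Decidable using (_×-dec_)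
  open import Relation.Unary using (Pred; Decidable)
  open import Relation.Binary.PropositionalEquality
  open import Algebra.Properties.CommutativeSemigroup +-commutativeSemigroup using (interchange)
  open import Algebra.Properties.CommutativeMonoid.Sum +-0-commutativeMonoid
    using (sum; sum-syntax; sum-cong-≗; ∑-distrib-+; sum-remove; sum-replicate-zero)
    public

  indicator : ∀ {p} {P : Set p} → Dec P → ℕ
  indicator d = if does d then 1 else 0

  indicator-yes : ∀ {p} {P : Set p} → P → (d : Dec P) → indicator d ≡ 1
  indicator-yes p (yes _) = refl
  indicator-yes p (no ¬p) = ⊥-elim (¬p p)

  indicator-no : ∀ {p} {P : Set p} → ¬ P → (d : Dec P) → indicator d ≡ 0
  indicator-no ¬p (yes p) = ⊥-elim (¬p p)
  indicator-no ¬p (no _)  = refl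

  δ : ℕ → ℕ → ℕ
  δ x y = indicator (x ≟ y)

  indicator-×-dec : ∀ {p q} {P : Set p} {Q : Set q} (P? : Dec P) (Q? : Dec Q) →
    indicator (P? ×-dec Q?) ≡ indicator P? * indicator Q?
  indicator-×-dec P? Q? with does P? | does Q?
  ... | true  | true  = refl
  ... | true  | false = refl
  ... | false | _     = refl

  listSum : ∀ {A : Set} → (A → ℕ) → List A → ℕ
  listSum q []       = 0
  listSum q (x ∷ xs) = q x + listSum q xs

  module _ {A : Set} where

    listSum-cong : ∀ {q r : A → ℕ} → (∀ x → q x ≡ r x) → ∀ xs → listSum q xs ≡ listSum r xs
    listSum-cong q≗r []       = refl
    listSum-cong q≗r (x ∷ xs) = cong₂ _+_ (q≗r x) (listSum-cong q≗r xs)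

    listSum-zero : ∀ (q : A → ℕ) → (∀ x → q x ≡ 0) → ∀ xs → listSum q xs ≡ 0
    listSum-zero q q≡0 []       = refl
    listSum-zero q q≡0 (x ∷ xs) = cong₂ _+_ (q≡0 x) (listSum-zero q q≡0 xs)

    listSum-+ : ∀ (q r : A → ℕ) xs → listSum (λ x → q x + r x) xs ≡ listSum q xs + listSum r xs
    listSum-+ q r []       = refl
    listSum-+ q r (x ∷ xs) = trans (cong (q x + r x +_) (listSum-+ q r xs)) (interchange (q x) (r x) _ _)

    listSum-++ : ∀ (q : A → ℕ) xs ys → listSum q (xs ++ ys) ≡ listSum q xs + listSum q ys
    listSum-++ q []       ys = refl
    listSum-++ q (x ∷ xs) ys = trans (cong (q x +_) (listSum-++ q xs ys)) (sym (+-assoc (q x) _ _))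

    length-filter : ∀ {P : Pred A 0ℓ} (P? : Decidable P) xs →
      length (filter P? xs) ≡ listSum (indicator ∘ P?) xs
    length-filter P? []       = refl
    length-filter P? (x ∷ xs) with does (P? x)
    ... | true  = cong suc (length-filter P? xs)
    ... | false = length-filter P? xs

    ∑-listSum : ∀ n (q : Fin n → A → ℕ) ws →
      (∑[ x < n ] listSum (q x) ws) ≡ listSum (λ w → ∑[ x < n ] q x w) ws
    ∑-listSum n q []       = sum-replicate-zero n
    ∑-listSum n q (w ∷ ws) =
      trans (∑-distrib-+ {n} (λ x → q x w) (λ x → listSum (q x) ws)) (cong (sum {n} (λ x → q x w) +_) (∑-listSum n q ws))

  module _ {A B : Set} where

    listSum-map : ∀ (q : B → ℕ) (f : A → B) xs → listSum q (map f xs) ≡ listSum (q ∘ f) xs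
    listSum-map q f []       = refl
    listSum-map q f (x ∷ xs) = cong (q (f x) +_) (listSum-map q f xs)

    listSum-concatMap : ∀ (q : B → ℕ) (f : A → List B) xs →
      listSum q (concatMap f xs) ≡ listSum (listSum q ∘ f) xs
    listSum-concatMap q f []       = refl
    listSum-concatMap q f (x ∷ xs) =
      trans (listSum-++ q (f x) (concatMap f xs)) (cong (listSum q (f x) +_) (listSum-concatMap q f xs))

  listSum-tabulate : ∀ {B : Set} n (q : B → ℕ) (f : Fin n → B) → listSum q (tabulate f) ≡ ∑[ i < n ] q (f i)
  listSum-tabulate zero    q f = refl
  listSum-tabulate (suc n) q f = cong (q (f Fin.zero) +_) (listSum-tabulate n q (f ∘ Fin.suc))

  listSum-words : ∀ n k (q : Vec (Fin n) (suc k) → ℕ) →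
    listSum q (words n (suc k)) ≡ ∑[ x < n ] listSum (q ∘ (x ∷_)) (words n k)
  listSum-words n k q = begin
    listSum q (words n (suc k))
      ≡⟨ listSum-concatMap q _ (allFin n) ⟩
    listSum (λ x → listSum q (map (x ∷_) (words n k))) (allFin n)
      ≡⟨ listSum-cong (λ x → listSum-map q (x ∷_) (words n k)) (allFin n) ⟩
    listSum (λ x → listSum (q ∘ (x ∷_)) (words n k)) (allFin n)
      ≡⟨ listSum-tabulate n (λ x → listSum (q ∘ (x ∷_)) (words n k)) id ⟩
    (∑[ x < n ] listSum (q ∘ (x ∷_)) (words n k))
      ∎
    where open ≡-Reasoning

  _occursIn_ : ∀ {A : Set} {k} → A → Vec A k → Set
  x occursIn w = ∃ λ i → lookup w i ≡ x

  listSum-words-avoiding : ∀ {n} k (x : Fin (suc n)) (q : Vec (Fin (suc n)) k → ℕ) →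
    (∀ w → x occursIn w → q w ≡ 0) →
    listSum q (words (suc n) k) ≡ listSum (q ∘ Vec.map (punchIn x)) (words n k)
  listSum-words-avoiding zero    x q q-vanishes = refl
  listSum-words-avoiding {n} (suc k) x q q-vanishes = begin
    listSum q (words (suc n) (suc k))
      ≡⟨ listSum-words (suc n) k q ⟩
    (∑[ y < suc n ] listSum (q ∘ (y ∷_)) (words (suc n) k))
      ≡⟨ sum-remove {i = x} (λ y → listSum (q ∘ (y ∷_)) (words (suc n) k)) ⟩
    listSum (q ∘ (x ∷_)) (words (suc n) k) + (∑[ z < n ] listSum (q ∘ (punchIn x z ∷_)) (words (suc n) k))
      ≡⟨ cong₂ _+_ x-first rest ⟩
    (∑[ z < n ] listSum (λ w → q (punchIn x z ∷ Vec.map (punchIn x) w)) (words n k))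
      ≡⟨ listSum-words n k (q ∘ Vec.map (punchIn x)) ⟨
    listSum (q ∘ Vec.map (punchIn x)) (words n (suc k))
      ∎
    where
    open ≡-Reasoning
    x-first : listSum (q ∘ (x ∷_)) (words (suc n) k) ≡ 0
    x-first = listSum-zero _ (λ w → q-vanishes (x ∷ w) (Fin.zero , refl)) (words (suc n) k)
    rest : (∑[ z < n ] listSum (q ∘ (punchIn x z ∷_)) (words (suc n) k))
         ≡ (∑[ z < n ] listSum (λ w → q (punchIn x z ∷ Vec.map (punchIn x) w)) (words n k))
    rest = sum-cong-≗ {n} λ z →
      listSum-words-avoiding k x (q ∘ (punchIn x z ∷_)) (λ { w (i , eq) → q-vanishes _ (Fin.suc i , eq) })

module Insertion where

  open import Data.Nat using (ℕ; suc; _≤_; _<_; z≤n; s≤s; z<s)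
  open import Data.Nat.Properties using (suc-injective)
  open import Data.Fin using (Fin; toℕ; punchIn)
  import Data.Fin as Fin
  open import Data.Fin.Properties using (punchIn-injective; punchInᵢ≢i)
    renaming (suc-injective to Fin-suc-injective)
  open import Data.Vec using (_∷_; lookup)
  import Data.Vec as Vec
  open import Data.Vec.Properties using (lookup-map)
  open import Data.Product using (∃; _×_; _,_)
  open import Data.Sum using (_⊎_; inj₁; inj₂; [_,_]′)
  open import Data.Empty using (⊥-elim)
  open import Function using (_∘_)
  open import Relation.Nullary using (¬_)
  open import Relation.Binary.PropositionalEquality

  -- For a word π the defining conditions of Defs
  -- (IsPerm, Contains213, Contains32-1, InC) are exactly the following conditions on
  -- the sequence  lookup π,  so every statement below applies to words verbatim.
  Seq : ℕ → Set
  Seq n = Fin n → Fin n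

  module _ {n : ℕ} where

    IsPermSeq : Seq n → Set
    IsPermSeq g = ∀ i j → g i ≡ g j → i ≡ j

    Has213 : Seq n → Set
    Has213 g = ∃ λ (i : Fin n) → ∃ λ (j : Fin n) → ∃ λ (k : Fin n) →
      (i Fin.< j) × (j Fin.< k) × (g j Fin.< g i) × (g i Fin.< g k)

    Has32-1 : Seq n → Set
    Has32-1 g = ∃ λ (i : Fin n) → ∃ λ (j : Fin n) → ∃ λ (k : Fin n) →
      (toℕ j ≡ suc (toℕ i)) × (j Fin.< k) × (g k Fin.< g j) × (g j Fin.< g i)

    InCSeq : Seq n → Set
    InCSeq g = IsPermSeq g × ¬ Has213 g × ¬ Has32-1 g

    InCSeq-≗ : ∀ {f g : Seq n} → f ≗ g → InCSeq f → InCSeq g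
    InCSeq-≗ {f} {g} f≗g (perm , no213 , no32-1) = perm′ , no213 ∘ has213 , no32-1 ∘ has32-1
      where
      perm′ : IsPermSeq g
      perm′ i j eq = perm i j (trans (f≗g i) (trans eq (sym (f≗g j))))
      has213 : Has213 g → Has213 f
      has213 (i , j , k , i<j , j<k , gj<gi , gi<gk) =
        i , j , k , i<j , j<k , subst₂ Fin._<_ (sym (f≗g j)) (sym (f≗g i)) gj<gi
                              , subst₂ Fin._<_ (sym (f≗g i)) (sym (f≗g k)) gi<gk
      has32-1 : Has32-1 g → Has32-1 f
      has32-1 (i , j , k , j≡i+1 , j<k , gk<gj , gj<gi) =
        i , j , k , j≡i+1 , j<k , subst₂ Fin._<_ (sym (f≗g k)) (sym (f≗g j)) gk<gj
                                , subst₂ Fin._<_ (sym (f≗g j)) (sym (f≗g i)) gj<gi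

  punchIn-< : ∀ {n} (x : Fin (suc n)) {y z : Fin n} → y Fin.< z → punchIn x y Fin.< punchIn x z
  punchIn-< Fin.zero    y<z = s≤s y<z
  punchIn-< (Fin.suc x) {Fin.zero}  {Fin.suc z} y<z       = z<s
  punchIn-< (Fin.suc x) {Fin.suc y} {Fin.suc z} (s≤s y<z) = s≤s (punchIn-< x y<z)

  punchIn-<⁻ : ∀ {n} (x : Fin (suc n)) {y z : Fin n} → punchIn x y Fin.< punchIn x z → y Fin.< z
  punchIn-<⁻ Fin.zero    (s≤s y<z) = y<z
  punchIn-<⁻ (Fin.suc x) {Fin.zero}  {Fin.zero}  ()
  punchIn-<⁻ (Fin.suc x) {Fin.zero}  {Fin.suc z} _         = z<s
  punchIn-<⁻ (Fin.suc x) {Fin.suc y} {Fin.zero}  ()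
  punchIn-<⁻ (Fin.suc x) {Fin.suc y} {Fin.suc z} (s≤s y<z) = s≤s (punchIn-<⁻ x y<z)

  punchIn-below : ∀ {n} (x : Fin (suc n)) (y : Fin n) → toℕ y < toℕ x → toℕ (punchIn x y) ≡ toℕ y
  punchIn-below (Fin.suc x) Fin.zero    _         = refl
  punchIn-below (Fin.suc x) (Fin.suc y) (s≤s y<x) = cong suc (punchIn-below x y y<x)

  punchIn<x : ∀ {n} (x : Fin (suc n)) (y : Fin n) → toℕ y < toℕ x → punchIn x y Fin.< x
  punchIn<x (Fin.suc x) Fin.zero    _         = z<s
  punchIn<x (Fin.suc x) (Fin.suc y) (s≤s y<x) = s≤s (punchIn<x x y y<x)

  punchIn<x⁻ : ∀ {n} (x : Fin (suc n)) (y : Fin n) → punchIn x y Fin.< x → toℕ y < toℕ x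
  punchIn<x⁻ (Fin.suc x) Fin.zero    _         = z<s
  punchIn<x⁻ (Fin.suc x) (Fin.suc y) (s≤s y<x) = s≤s (punchIn<x⁻ x y y<x)

  x<punchIn : ∀ {n} (x : Fin (suc n)) (y : Fin n) → toℕ x ≤ toℕ y → x Fin.< punchIn x y
  x<punchIn Fin.zero    y           _         = z<s
  x<punchIn (Fin.suc x) (Fin.suc y) (s≤s x≤y) = s≤s (x<punchIn x y x≤y)

  x<punchIn⁻ : ∀ {n} (x : Fin (suc n)) (y : Fin n) → x Fin.< punchIn x y → toℕ x ≤ toℕ y
  x<punchIn⁻ Fin.zero    y           _         = z≤n
  x<punchIn⁻ (Fin.suc x) (Fin.suc y) (s≤s x<y) = s≤s (x<punchIn⁻ x y x<y)

  prepend : ∀ {n} → Fin (suc n) → Seq n → Seq (suc n)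
  prepend x g Fin.zero    = x
  prepend x g (Fin.suc i) = punchIn x (g i)

  ins : ∀ {n} → Fin (suc n) → Word n → Word (suc n)
  ins x σ = x ∷ Vec.map (punchIn x) σ

  lookup-ins : ∀ {n} (x : Fin (suc n)) (σ : Word n) → lookup (ins x σ) ≗ prepend x (lookup σ)
  lookup-ins x σ Fin.zero    = refl
  lookup-ins x σ (Fin.suc i) = lookup-map i (punchIn x) σ

  module _ {n : ℕ} (x : Fin (suc n)) (g : Seq n) where

    IsPermSeq-prepend⁺ : IsPermSeq g → IsPermSeq (prepend x g)
    IsPermSeq-prepend⁺ perm Fin.zero    Fin.zero    _  = refl
    IsPermSeq-prepend⁺ perm Fin.zero    (Fin.suc j) eq = ⊥-elim (punchInᵢ≢i x (g j) (sym eq))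
    IsPermSeq-prepend⁺ perm (Fin.suc i) Fin.zero    eq = ⊥-elim (punchInᵢ≢i x (g i) eq)
    IsPermSeq-prepend⁺ perm (Fin.suc i) (Fin.suc j) eq = cong Fin.suc (perm i j (punchIn-injective x _ _ eq))

    IsPermSeq-prepend⁻ : IsPermSeq (prepend x g) → IsPermSeq g
    IsPermSeq-prepend⁻ perm i j eq = Fin-suc-injective (perm (Fin.suc i) (Fin.suc j) (cong (punchIn x) eq))

    -- the occurrences of 2-1-3 in prepend x g that start with x
    New213 : Set
    New213 = ∃ λ (j : Fin n) → ∃ λ (k : Fin n) → (j Fin.< k) × (toℕ (g j) < toℕ x) × (toℕ x ≤ toℕ (g k))

    Has213-prepend⁺ : Has213 g ⊎ New213 → Has213 (prepend x g)
    Has213-prepend⁺ (inj₁ (i , j , k , i<j , j<k , gj<gi , gi<gk)) =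
      Fin.suc i , Fin.suc j , Fin.suc k , s≤s i<j , s≤s j<k , punchIn-< x gj<gi , punchIn-< x gi<gk
    Has213-prepend⁺ (inj₂ (j , k , j<k , gj<x , x≤gk)) =
      Fin.zero , Fin.suc j , Fin.suc k , z<s , s≤s j<k , punchIn<x x (g j) gj<x , x<punchIn x (g k) x≤gk

    Has213-prepend⁻ : Has213 (prepend x g) → Has213 g ⊎ New213
    Has213-prepend⁻ (Fin.zero , Fin.suc j , Fin.suc k , _ , s≤s j<k , a , b) =
      inj₂ (j , k , j<k , punchIn<x⁻ x (g j) a , x<punchIn⁻ x (g k) b)
    Has213-prepend⁻ (Fin.suc i , Fin.suc j , Fin.suc k , s≤s i<j , s≤s j<k , a , b) =
      inj₁ (i , j , k , i<j , j<k , punchIn-<⁻ x a , punchIn-<⁻ x b)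
    Has213-prepend⁻ (Fin.zero  , Fin.zero  , _ , () , _)
    Has213-prepend⁻ (_ , Fin.suc j , Fin.zero , _ , () , _)
    Has213-prepend⁻ (Fin.suc i , Fin.zero  , _ , () , _)

  module _ {m : ℕ} (x : Fin (suc (suc m))) (g : Seq (suc m)) where

    -- the occurrences of 32-1 in prepend x g that start with x
    New32-1 : Set
    New32-1 = (toℕ (g Fin.zero) < toℕ x) × ∃ λ (k : Fin (suc m)) → (0 < toℕ k) × (g k Fin.< g Fin.zero)

    Has32-1-prepend⁺ : Has32-1 g ⊎ New32-1 → Has32-1 (prepend x g)
    Has32-1-prepend⁺ (inj₁ (i , j , k , j≡i+1 , j<k , gk<gj , gj<gi)) =
      Fin.suc i , Fin.suc j , Fin.suc k , cong suc j≡i+1 , s≤s j<k , punchIn-< x gk<gj , punchIn-< x gj<gi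
    Has32-1-prepend⁺ (inj₂ (g0<x , k , 0<k , gk<g0)) =
      Fin.zero , Fin.suc Fin.zero , Fin.suc k , refl , s≤s 0<k , punchIn-< x gk<g0 , punchIn<x x (g Fin.zero) g0<x

    Has32-1-prepend⁻ : Has32-1 (prepend x g) → Has32-1 g ⊎ New32-1
    Has32-1-prepend⁻ (Fin.zero , Fin.suc Fin.zero , Fin.suc k , _ , s≤s 0<k , a , b) =
      inj₂ (punchIn<x⁻ x (g Fin.zero) b , k , 0<k , punchIn-<⁻ x a)
    Has32-1-prepend⁻ (Fin.suc i , Fin.suc j , Fin.suc k , j≡i+1 , s≤s j<k , a , b) =
      inj₁ (i , j , k , suc-injective j≡i+1 , j<k , punchIn-<⁻ x a , punchIn-<⁻ x b)
    Has32-1-prepend⁻ (Fin.zero , Fin.zero , _ , () , _)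
    Has32-1-prepend⁻ (Fin.zero , Fin.suc (Fin.suc j) , _ , () , _)
    Has32-1-prepend⁻ (_ , Fin.suc j , Fin.zero , _ , () , _)
    Has32-1-prepend⁻ (Fin.suc i , Fin.zero , _ , () , _)

    InCSeq-prepend⁻ : InCSeq (prepend x g) → InCSeq g × ¬ New213 x g × ¬ New32-1
    InCSeq-prepend⁻ (perm , no213 , no32-1) =
      (IsPermSeq-prepend⁻ x g perm , no213 ∘ Has213-prepend⁺ x g ∘ inj₁ , no32-1 ∘ Has32-1-prepend⁺ ∘ inj₁) ,
      no213 ∘ Has213-prepend⁺ x g ∘ inj₂ , no32-1 ∘ Has32-1-prepend⁺ ∘ inj₂

    InCSeq-prepend⁺ : InCSeq g → ¬ New213 x g → ¬ New32-1 → InCSeq (prepend x g)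
    InCSeq-prepend⁺ (perm , no213 , no32-1) no-new213 no-new32-1 =
      IsPermSeq-prepend⁺ x g perm ,
      [ no213 , no-new213 ]′ ∘ Has213-prepend⁻ x g ,
      [ no32-1 , no-new32-1 ]′ ∘ Has32-1-prepend⁻

module FirstLetter where

  open Insertion
  open import Data.Nat using (ℕ; suc; _≤_; _<_; z≤n; s≤s; z<s)
  open import Data.Nat.Properties
    using ( ≤-refl; ≤-trans; <-trans; ≤-reflexive; ≮⇒≥; <⇒≱; ≤∧≢⇒<; <-irrefl; ≤-antisym
          ; ≤∧≮⇒≡; n≮0; 0≢1+n; 1+n≰n; ≰⇒>; <-cmp; _<?_; _≤?_; _≟_
          )
  open import Data.Fin using (Fin; toℕ; fromℕ; fromℕ<; inject₁; punchOut)
  import Data.Fin as Fin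
  open import Data.Fin.Properties
    using ( any?; toℕ-injective; toℕ-inject₁; toℕ-fromℕ; toℕ-fromℕ<; toℕ<n; toℕ≤pred[n]
          ; injective⇒≤; punchOut-injective
          ) renaming (_≟_ to _≟ᶠ_)
  open import Data.Fin.Induction using (<-weakInduction)
  open import Data.Product using (∃; _×_; _,_; proj₁; proj₂)
  open import Data.Sum using (_⊎_; inj₁; inj₂)
  open import Data.Empty using (⊥-elim)
  open import Function using (_∘_; case_of_)
  open import Relation.Nullary using (¬_; yes; no)
  open import Relation.Binary using (tri<; tri≈; tri>)
  open import Relation.Binary.PropositionalEquality

  <⇒≢ᶠ : ∀ {n} {i j : Fin n} → toℕ i < toℕ j → i ≢ j
  <⇒≢ᶠ i<j i≡j = <-irrefl (cong toℕ i≡j) i<j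

  IsPermSeq-surjective : ∀ {n} {g : Seq n} → IsPermSeq g → ∀ y → ∃ λ i → g i ≡ y
  IsPermSeq-surjective {n} {g} perm y with any? (λ i → g i ≟ᶠ y)
  ... | yes hit = hit
  IsPermSeq-surjective {suc n} {g} perm y | no miss = ⊥-elim (1+n≰n (injective⇒≤ squeeze-injective))
    where
    -- without the value y, g would squeeze Fin (n+1) injectively into Fin n
    squeeze : Fin (suc n) → Fin n
    squeeze i = punchOut {i = y} {j = g i} (λ y≡gi → miss (i , sym y≡gi))
    squeeze-injective : ∀ {i j} → squeeze i ≡ squeeze j → i ≡ j
    squeeze-injective {i} {j} eq = perm i j (punchOut-injective {i = y} _ _ eq)

  Descent : ∀ {n} → Seq n → Fin n → Fin n → Set
  Descent g i j = (toℕ j ≡ suc (toℕ i)) × (g j Fin.< g i)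

  -- The shape of a sequence of 𝒞: left of the position of the least letter 0 it rises,
  -- and if it does not start with 0 everything from that position on lies below g 0.
  module Shape {m : ℕ} {g : Seq (suc m)} (inC : InCSeq g) where

    private
      perm : IsPermSeq g
      perm = proj₁ inC
      no213 : ¬ Has213 g
      no213 = proj₁ (proj₂ inC)
      no32-1 : ¬ Has32-1 g
      no32-1 = proj₂ (proj₂ inC)

    minPos : Fin (suc m)
    minPos = proj₁ (IsPermSeq-surjective perm Fin.zero)

    g-minPos : g minPos ≡ Fin.zero
    g-minPos = proj₂ (IsPermSeq-surjective perm Fin.zero)

    g-minPos< : ∀ i → i ≢ minPos → g minPos Fin.< g i
    g-minPos< i i≢p rewrite g-minPos with g i in eq
    ... | Fin.zero  = ⊥-elim (i≢p (perm i minPos (trans eq (sym g-minPos))))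
    ... | Fin.suc _ = z<s

    -- a drop before minPos would be the 32 of a 32-1 whose 1 is the least letter
    rising-before-min : ∀ i → toℕ i < toℕ minPos → toℕ (g Fin.zero) ≤ toℕ (g i)
    rising-before-min = <-weakInduction P (λ _ → ≤-refl) step
      where
      P : Fin (suc m) → Set
      P i = toℕ i < toℕ minPos → toℕ (g Fin.zero) ≤ toℕ (g i)
      step : ∀ i → P (inject₁ i) → P (Fin.suc i)
      step i ih i+1<p = ≤-trans (ih i<p) (≮⇒≥ no-drop)
        where
        i+1≡ : toℕ (Fin.suc i) ≡ suc (toℕ (inject₁ i))
        i+1≡ = cong suc (sym (toℕ-inject₁ i))
        i<p : toℕ (inject₁ i) < toℕ minPos
        i<p = <-trans (≤-reflexive (sym i+1≡)) i+1<p
        no-drop : ¬ g (Fin.suc i) Fin.< g (inject₁ i)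
        no-drop drop = no32-1 (inject₁ i , Fin.suc i , minPos , i+1≡ , i+1<p ,
                               g-minPos< (Fin.suc i) (<⇒≢ᶠ i+1<p) , drop)

    module _ (g0≢0 : g Fin.zero ≢ Fin.zero) where

      minPos≢0 : Fin.zero ≢ minPos
      minPos≢0 0≡p = g0≢0 (trans (cong g 0≡p) g-minPos)

      -- an entry ≥ g 0 after minPos would be the 3 of a 2-1-3 starting with g 0, 1
      below-first-from-min : ∀ k → toℕ minPos ≤ toℕ k → g k Fin.< g Fin.zero
      below-first-from-min k p≤k with toℕ minPos ≟ toℕ k
      ... | yes p≡k = subst (λ i → g i Fin.< g Fin.zero) (toℕ-injective p≡k) (g-minPos< Fin.zero minPos≢0)
      ... | no p≢k with toℕ (g k) <? toℕ (g Fin.zero)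
      ...   | yes gk<g0 = gk<g0
      ...   | no gk≮g0 = ⊥-elim (no213 (Fin.zero , minPos , k , 0<p , p<k , g-minPos< Fin.zero minPos≢0 , g0<gk))
        where
        p<k : toℕ minPos < toℕ k
        p<k = ≤∧≢⇒< p≤k p≢k
        0<p : 0 < toℕ minPos
        0<p = ≤∧≢⇒< z≤n (minPos≢0 ∘ toℕ-injective)
        g0<gk : g Fin.zero Fin.< g k
        g0<gk = ≤∧≢⇒< (≮⇒≥ gk≮g0) (λ eq → <⇒≢ᶠ (<-trans 0<p p<k) (perm _ _ (toℕ-injective eq)))

      -- a descent bottom before minPos would be the 2 of a 32-1 whose 1 is the least letter
      descent-below-first : ∀ {i j} → Descent g i j → g j Fin.< g Fin.zero
      descent-below-first {i} {j} (j≡i+1 , gj<gi) with toℕ minPos ≤? toℕ j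
      ... | yes p≤j = below-first-from-min j p≤j
      ... | no p≰j = ⊥-elim (no32-1 (i , j , minPos , j≡i+1 , j<p , g-minPos< j (<⇒≢ᶠ j<p) , gj<gi))
        where
        j<p : toℕ j < toℕ minPos
        j<p = ≰⇒> p≰j

  Admissible : ∀ {m} → Fin (suc (suc m)) → Seq (suc m) → Set
  Admissible x g = ¬ New213 x g × ¬ New32-1 x g

  predOrTop : ∀ {m} → Fin (suc m) → Fin (suc m)
  predOrTop {m} Fin.zero    = fromℕ m
  predOrTop     (Fin.suc j) = inject₁ j

  -- The second admissible first letter for a sequence starting with y: the new top
  -- letter m+1 if y = 0, and otherwise the letter y itself (the old y moving up to y+1).
  secondLetter : ∀ {m} → Fin (suc m) → Fin (suc (suc m))
  secondLetter y = Fin.suc (predOrTop y)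

  below-secondLetter-zero : ∀ {m} (y : Fin (suc m)) → toℕ y < toℕ (secondLetter {m} Fin.zero)
  below-secondLetter-zero {m} y = subst (toℕ y <_) (cong suc (sym (toℕ-fromℕ m))) (toℕ<n y)

  toℕ-secondLetter-suc : ∀ {m} (j : Fin m) → toℕ (secondLetter (Fin.suc j)) ≡ suc (toℕ j)
  toℕ-secondLetter-suc j = cong suc (toℕ-inject₁ j)

  -- nothing lies below the letter 0, so prepending it creates no pattern
  zero-admissible : ∀ {m} (g : Seq (suc m)) → Admissible Fin.zero g
  zero-admissible g = (λ { (_ , _ , _ , () , _) }) , (λ { (() , _) })

  secondLetter-admissible : ∀ {m} {g : Seq (suc m)} → InCSeq g → Admissible (secondLetter (g Fin.zero)) g
  secondLetter-admissible {m} {g} (perm , no213 , _) = admissible (g Fin.zero) refl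
    where
    admissible : ∀ y → g Fin.zero ≡ y → Admissible (secondLetter y) g
    admissible Fin.zero g0≡0 = no-new213 , no-new32-1
      where
      -- no letter of g reaches the new top letter
      no-new213 : ¬ New213 (secondLetter Fin.zero) g
      no-new213 (_ , k , _ , _ , top≤gk) = <⇒≱ (below-secondLetter-zero (g k)) top≤gk
      -- no letter lies below g 0 = 0
      no-new32-1 : ¬ New32-1 (secondLetter Fin.zero) g
      no-new32-1 (_ , k , _ , gk<g0) rewrite g0≡0 = ⊥-elim (n≮0 gk<g0)
    admissible (Fin.suc j) g0≡y = no-new213 , no-new32-1
      where
      x-value : toℕ (secondLetter (Fin.suc j)) ≡ toℕ (g Fin.zero)
      x-value = trans (toℕ-secondLetter-suc j) (sym (cong toℕ g0≡y))
      no-new32-1 : ¬ New32-1 (secondLetter (Fin.suc j)) g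
      no-new32-1 (g0<x , _) = <-irrefl (sym x-value) g0<x
      -- a new 2-1-3 would already be one of g, with g 0 in place of the new letter
      no-new213 : ¬ New213 (secondLetter (Fin.suc j)) g
      no-new213 (i , k , i<k , gi<x , x≤gk) = no213 (Fin.zero , i , k , 0<i , i<k , gi<g0 , g0<gk)
        where
        gi<g0 : g i Fin.< g Fin.zero
        gi<g0 = subst (toℕ (g i) <_) x-value gi<x
        0<i : 0 < toℕ i
        0<i = ≤∧≢⇒< z≤n (λ 0≡i → <-irrefl (sym (cong (toℕ ∘ g) (toℕ-injective 0≡i))) gi<g0)
        g0<gk : g Fin.zero Fin.< g k
        g0<gk = ≤∧≢⇒< (subst (_≤ toℕ (g k)) x-value x≤gk)
                       (λ eq → <⇒≢ᶠ (<-trans 0<i i<k) (perm _ _ (toℕ-injective eq)))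

  -- When g starts with 0, only the top letter can be prepended besides 0: for x < m the new
  -- first letter x+1, g 0 = 0 and the letter x+1 of g (now x+2) would form a new 2-1-3.
  only-top : ∀ {m} {g : Seq (suc m)} → IsPermSeq g → g Fin.zero ≡ Fin.zero → ∀ x →
    ¬ New213 (Fin.suc x) g → x ≡ fromℕ m
  only-top {m} {g} perm g0≡0 x no-new213 = toℕ-injective (trans (≤∧≮⇒≡ (toℕ≤pred[n] x) x≮m) (sym (toℕ-fromℕ m)))
    where
    x≮m : ¬ toℕ x < m
    x≮m x<m with IsPermSeq-surjective perm (fromℕ< (s≤s x<m))
    ... | k , gk≡x+1 = no-new213 (Fin.zero , k , 0<k , subst (λ z → toℕ z < suc (toℕ x)) (sym g0≡0) z<s , x+1≤gk)
      where
      x+1≤gk : suc (toℕ x) ≤ toℕ (g k)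
      x+1≤gk = ≤-reflexive (sym (trans (cong toℕ gk≡x+1) (toℕ-fromℕ< (s≤s x<m))))
      0<k : 0 < toℕ k
      0<k = ≤∧≢⇒< z≤n λ 0≡k →
        n≮0 (subst (λ z → suc (toℕ x) ≤ toℕ z) (trans (cong g (sym (toℕ-injective 0≡k))) g0≡0) x+1≤gk)

  only-first : ∀ {m} {g : Seq (suc m)} → InCSeq g → ∀ j → g Fin.zero ≡ Fin.suc j → ∀ x →
    Admissible (Fin.suc x) g → x ≡ inject₁ j
  only-first {m} {g} inC j g0≡j+1 x (no-new213 , no-new32-1) =
    toℕ-injective (trans (≤-antisym x≤j j≤x) (sym (toℕ-inject₁ j)))
    where
    open Shape inC
    g0≢0 : g Fin.zero ≢ Fin.zero
    g0≢0 g0≡0 with () ← trans (sym g0≡j+1) g0≡0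
    g0-value : toℕ (g Fin.zero) ≡ suc (toℕ j)
    g0-value = cong toℕ g0≡j+1
    -- if j < x, then g 0 < x+1 and the least letter comes later: a new 32-1
    x≤j : toℕ x ≤ toℕ j
    x≤j = ≮⇒≥ λ j<x → no-new32-1 (subst (_< suc (toℕ x)) (sym g0-value) (s≤s j<x) ,
                                  minPos , ≤∧≢⇒< z≤n (minPos≢0 g0≢0 ∘ toℕ-injective) ,
                                  g-minPos< Fin.zero (minPos≢0 g0≢0))
    -- if x < j, the letter x+1 of g lies right of the least letter (left of it g rises
    -- from g 0 = j+1), so the new first letter, the least letter and that letter (now
    -- x+2) would form a new 2-1-3
    after-min : toℕ x < toℕ j → ∀ q → toℕ (g q) ≡ suc (toℕ x) → toℕ minPos < toℕ q
    after-min x<j q gq-value with <-cmp (toℕ minPos) (toℕ q)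
    ... | tri< p<q _ _ = p<q
    ... | tri≈ _ p≡q _ = ⊥-elim (0≢1+n (trans (sym (cong toℕ g-minPos)) (trans (cong (toℕ ∘ g) (toℕ-injective p≡q)) gq-value)))
    ... | tri> _ _ q<p = ⊥-elim (<⇒≱ (s≤s x<j) (subst₂ _≤_ g0-value gq-value (rising-before-min q q<p)))
    j≤x : toℕ j ≤ toℕ x
    j≤x = ≮⇒≥ λ x<j → let x<m = <-trans x<j (toℕ<n j) in
      case IsPermSeq-surjective (proj₁ inC) (fromℕ< (s≤s x<m)) of λ where
        (q , gq≡x+1) → let gq-value = trans (cong toℕ gq≡x+1) (toℕ-fromℕ< (s≤s x<m)) in
          no-new213 (minPos , q , after-min x<j q gq-value ,
                     subst (λ z → toℕ z < suc (toℕ x)) (sym g-minPos) z<s , ≤-reflexive (sym gq-value))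

  admissible-cases : ∀ {m} {g : Seq (suc m)} → InCSeq g → ∀ x → Admissible x g →
    x ≡ Fin.zero ⊎ x ≡ secondLetter (g Fin.zero)
  admissible-cases inC Fin.zero _ = inj₁ refl
  admissible-cases {g = g} inC (Fin.suc x) admissible = inj₂ (cong Fin.suc (by-first-letter (g Fin.zero) refl))
    where
    by-first-letter : ∀ y → g Fin.zero ≡ y → x ≡ predOrTop y
    by-first-letter Fin.zero    g0≡0   = only-top (proj₁ inC) g0≡0 x (proj₁ admissible)
    by-first-letter (Fin.suc j) g0≡j+1 = only-first inC j g0≡j+1 x admissible

module Statistics where

  open Insertion
  open FirstLetter
  open import Data.Nat using (ℕ; zero; suc; _≤_; _<_; _⊔_; z≤n; s≤s; _≟_)
  open import Data.Nat.Properties using (≤-refl; ≤-trans; ≤-antisym; suc-injective; m≤m⊔n; m≤n⊔m; ⊔-sel; <-irrefl; <-asym)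
  open import Data.Fin using (Fin; toℕ; inject₁; punchIn)
  import Data.Fin as Fin
  open import Data.Fin.Properties using (all?; toℕ-inject₁)
  open import Data.Vec using (lookup)
  open import Data.List using ([]; _∷_; foldr; allFin)
  open import Data.List.Membership.Propositional using (_∈_)
  open import Data.List.Membership.Propositional.Properties using (∈-concatMap⁻; ∈-allFin)
  open import Data.List.Relation.Unary.Any using (here; there; satisfied)
  open import Data.List.Relation.Unary.All as All using (All)
  open import Data.List.Relation.Unary.All.Properties using (map⁻; concat⁻)
  open import Data.Product using (∃; _×_; _,_; proj₁; proj₂)
  open import Data.Sum using (_⊎_; inj₁; inj₂; [_,_]′)
  open import Data.Empty using (⊥-elim)
  open import Function using (_∘_; _⇔_; mk⇔; Equivalence)
  open import Relation.Nullary using (¬_; yes; no)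
  open import Relation.Binary.PropositionalEquality

  open Equivalence using (to; from)

  IsBottom : ∀ {n} → Seq n → ℕ → Set
  IsBottom g w = ∃ λ i → ∃ λ j → Descent g i j × suc (toℕ (g j)) ≡ w

  MaxBottom : ∀ {n} → Seq n → ℕ → Set
  MaxBottom g H = (∀ w → IsBottom g w → w ≤ H) × (H ≡ 0 ⊎ IsBottom g H)

  MaxBottom-unique : ∀ {n} {g : Seq n} {H H′} → MaxBottom g H → MaxBottom g H′ → H ≡ H′
  MaxBottom-unique {g = g} max max′ = ≤-antisym (bounded max max′) (bounded max′ max)
    where
    bounded : ∀ {H H′} → MaxBottom g H → MaxBottom g H′ → H ≤ H′
    bounded (_ , inj₁ refl)    _         = z≤n
    bounded (_ , inj₂ bottom) (ub′ , _) = ub′ _ bottom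

  -- the new value of h after prepending the least letter: every bottom moves up by one
  raise : ℕ → ℕ
  raise zero    = zero
  raise (suc H) = suc (suc H)

  -- the new value of h after adding a bottom of value 1
  max1 : ℕ → ℕ
  max1 zero    = 1
  max1 (suc H) = suc H

  raise-mono : ∀ {w H} → suc w ≤ H → suc (suc w) ≤ raise H
  raise-mono {H = suc _} w<H = s≤s w<H

  H≤max1 : ∀ H → H ≤ max1 H
  H≤max1 zero    = z≤n
  H≤max1 (suc _) = ≤-refl

  1≤max1 : ∀ H → 1 ≤ max1 H
  1≤max1 zero    = ≤-refl
  1≤max1 (suc _) = s≤s z≤n

  max1-≥1 : ∀ {H} → 1 ≤ H → max1 H ≡ H
  max1-≥1 {suc _} _ = refl

  module _ {n n′} {f : Seq n′} {g : Seq n} {H : ℕ} (max : MaxBottom g H) where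

    MaxBottom-same : (∀ w → IsBottom f w ⇔ IsBottom g w) → MaxBottom f H
    MaxBottom-same same = (λ w → proj₁ max w ∘ to (same w)) , [ inj₁ , inj₂ ∘ from (same H) ]′ (proj₂ max)

    MaxBottom-raise : (∀ w → IsBottom f w ⇔ ∃ λ w′ → IsBottom g w′ × w ≡ suc w′) → MaxBottom f (raise H)
    MaxBottom-raise raised = ub , attained (proj₂ max)
      where
      ub : ∀ w → IsBottom f w → w ≤ raise H
      ub w bottom with to (raised w) bottom
      ... | w′ , bottom′@(_ , _ , _ , refl) , refl = raise-mono (proj₁ max w′ bottom′)
      attained : H ≡ 0 ⊎ IsBottom g H → raise H ≡ 0 ⊎ IsBottom f (raise H)
      attained (inj₁ refl)                       = inj₁ refl
      attained (inj₂ bottom@(_ , _ , _ , refl)) = inj₂ (from (raised _) (_ , bottom , refl))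

    MaxBottom-max1 : (∀ w → IsBottom f w ⇔ (w ≡ 1 ⊎ IsBottom g w)) → MaxBottom f (max1 H)
    MaxBottom-max1 extended = ub , attained (proj₂ max)
      where
      ub : ∀ w → IsBottom f w → w ≤ max1 H
      ub w bottom = [ (λ { refl → 1≤max1 H }) , (λ bottom′ → ≤-trans (proj₁ max w bottom′) (H≤max1 H)) ]′ (to (extended w) bottom)
      attained : H ≡ 0 ⊎ IsBottom g H → max1 H ≡ 0 ⊎ IsBottom f (max1 H)
      attained (inj₁ refl)                       = inj₂ (from (extended 1) (inj₁ refl))
      attained (inj₂ bottom@(_ , _ , _ , refl)) = inj₂ (from (extended _) (inj₂ bottom))

  MaxBottom-≗ : ∀ {n} {f g : Seq n} {H} → f ≗ g → MaxBottom f H → MaxBottom g H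
  MaxBottom-≗ {f = f} {g} f≗g max = MaxBottom-same max λ w → mk⇔ (transport (sym ∘ f≗g)) (transport f≗g)
    where
    transport : ∀ {f g : Seq _} {w} → f ≗ g → IsBottom f w → IsBottom g w
    transport {f} {g} f≗g (i , j , (j≡i+1 , drop) , eq) =
      i , j , (j≡i+1 , subst₂ Fin._<_ (f≗g j) (f≗g i) drop) , trans (cong (suc ∘ toℕ) (sym (f≗g j))) eq

  foldr-⊔ : ∀ xs → (∀ w → w ∈ xs → w ≤ foldr _⊔_ 0 xs) × (foldr _⊔_ 0 xs ≡ 0 ⊎ foldr _⊔_ 0 xs ∈ xs)
  foldr-⊔ []       = (λ _ ()) , inj₁ refl
  foldr-⊔ (w ∷ ws) = ub , attained (⊔-sel w M)
    where
    M : ℕ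
    M = foldr _⊔_ 0 ws
    ub : ∀ v → v ∈ w ∷ ws → v ≤ w ⊔ M
    ub v (here refl) = m≤m⊔n w M
    ub v (there v∈ws) = ≤-trans (proj₁ (foldr-⊔ ws) v v∈ws) (m≤n⊔m w M)
    attained : w ⊔ M ≡ w ⊎ w ⊔ M ≡ M → w ⊔ M ≡ 0 ⊎ w ⊔ M ∈ w ∷ ws
    attained (inj₁ ≡w) = inj₂ (here ≡w)
    attained (inj₂ ≡M) = [ inj₁ ∘ trans ≡M , (λ M∈ws → inj₂ (there (subst (_∈ ws) (sym ≡M) M∈ws))) ]′ (proj₂ (foldr-⊔ ws))

  ∈-descentBottoms⁻ : ∀ {n} (π : Word n) {w} → w ∈ descentBottoms π → IsBottom (lookup π) w
  ∈-descentBottoms⁻ {n} π w∈ with satisfied (∈-concatMap⁻ _ {xs = allFin n} w∈)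
  ... | i , w∈ᵢ with satisfied (∈-concatMap⁻ _ {xs = allFin n} w∈ᵢ)
  ... | j , w∈ᵢⱼ with toℕ j ≟ suc (toℕ i) | lookup π j Fin.<? lookup π i
  ... | yes j≡i+1 | yes drop with here refl ← w∈ᵢⱼ = i , j , (j≡i+1 , drop) , refl
  ... | yes _     | no _     with () ← w∈ᵢⱼ
  ... | no _      | _        with () ← w∈ᵢⱼ

  All-descentBottoms : ∀ {n} (π : Word n) {P : ℕ → Set} → All P (descentBottoms π) → ∀ {w} → IsBottom (lookup π) w → P w
  All-descentBottoms {n} π all (i , j , (j≡i+1 , drop) , refl)
    with All.lookup (map⁻ (concat⁻ (All.lookup (map⁻ (concat⁻ all)) (∈-allFin i)))) (∈-allFin j)
  ... | listed with toℕ j ≟ suc (toℕ i) | lookup π j Fin.<? lookup π i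
  ...   | yes _    | yes _    = All.head listed
  ...   | yes _    | no ¬drop = ⊥-elim (¬drop drop)
  ...   | no j≢i+1 | _        = ⊥-elim (j≢i+1 j≡i+1)

  -- h π is the largest bottom value of π: the identity has no descent at all
  h-MaxBottom : ∀ {n} (π : Word n) → MaxBottom (lookup π) (h π)
  h-MaxBottom π with all? (λ i → lookup π i Fin.≟ i)
  ... | yes identity = (λ { w (i , j , (j≡i+1 , drop) , _) → ⊥-elim (no-drop i j j≡i+1 drop) }) , inj₁ refl
    where
    no-drop : ∀ i j → toℕ j ≡ suc (toℕ i) → ¬ lookup π j Fin.< lookup π i
    no-drop i j j≡i+1 drop = <-asym (subst₂ _<_ (cong toℕ (identity j)) (cong toℕ (identity i)) drop)
                                    (subst (toℕ i <_) (sym j≡i+1) ≤-refl)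
  ... | no _ = (λ w → All-descentBottoms π (All.tabulate (bound _))) , [ inj₁ , inj₂ ∘ ∈-descentBottoms⁻ π ]′ attained
    where
    bound : ∀ w → w ∈ descentBottoms π → w ≤ foldr _⊔_ 0 (descentBottoms π)
    bound = proj₁ (foldr-⊔ (descentBottoms π))
    attained : foldr _⊔_ 0 (descentBottoms π) ≡ 0 ⊎ foldr _⊔_ 0 (descentBottoms π) ∈ descentBottoms π
    attained = proj₂ (foldr-⊔ (descentBottoms π))

  bottoms-prepend-zero : ∀ {n} (g : Seq n) w →
    IsBottom (prepend Fin.zero g) w ⇔ ∃ λ w′ → IsBottom g w′ × w ≡ suc w′
  bottoms-prepend-zero g w = mk⇔ to′ from′
    where
    to′ : IsBottom (prepend Fin.zero g) w → ∃ λ w′ → IsBottom g w′ × w ≡ suc w′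
    to′ (Fin.suc i , Fin.suc j , (j≡i+1 , s≤s drop) , refl) = _ , (i , j , (suc-injective j≡i+1 , drop) , refl) , refl
    to′ (Fin.zero  , Fin.zero  , (() , _) , _)
    to′ (Fin.zero  , Fin.suc _ , (_ , ()) , _)
    to′ (Fin.suc _ , Fin.zero  , (() , _) , _)
    from′ : (∃ λ w′ → IsBottom g w′ × w ≡ suc w′) → IsBottom (prepend Fin.zero g) w
    from′ (_ , (i , j , (j≡i+1 , drop) , refl) , refl) = Fin.suc i , Fin.suc j , (cong suc j≡i+1 , s≤s drop) , refl

  module _ {n} (x : Fin (suc n)) (g : Seq n) where

    bottom-prepend⁺ : ∀ {w} → (b : IsBottom g w) → toℕ (g (proj₁ (proj₂ b))) < toℕ x → IsBottom (prepend x g) w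
    bottom-prepend⁺ (i , j , (j≡i+1 , drop) , refl) below =
      Fin.suc i , Fin.suc j , (cong suc j≡i+1 , punchIn-< x drop) , cong suc (punchIn-below x (g j) below)

    bottom-prepend⁻ : ∀ {i j} → Descent (prepend x g) (Fin.suc i) (Fin.suc j) → toℕ (g j) < toℕ x →
      IsBottom g (suc (toℕ (punchIn x (g j))))
    bottom-prepend⁻ {i} {j} (j≡i+1 , drop) below =
      i , j , (suc-injective j≡i+1 , punchIn-<⁻ x drop) , cong suc (sym (punchIn-below x (g j) below))

  bottoms-prepend-top : ∀ {m} (g : Seq (suc m)) → g Fin.zero ≡ Fin.zero → ∀ w →
    IsBottom (prepend (secondLetter Fin.zero) g) w ⇔ (w ≡ 1 ⊎ IsBottom g w)
  bottoms-prepend-top {m} g g0≡0 w = mk⇔ to′ from′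
    where
    x : Fin (suc (suc m))
    x = secondLetter Fin.zero
    first-value : suc (toℕ (punchIn x (g Fin.zero))) ≡ 1
    first-value = cong suc (trans (punchIn-below x (g Fin.zero) (below-secondLetter-zero _)) (cong toℕ g0≡0))
    to′ : IsBottom (prepend x g) w → w ≡ 1 ⊎ IsBottom g w
    to′ (Fin.zero  , Fin.suc Fin.zero , _ , refl)       = inj₁ first-value
    to′ (Fin.suc i , Fin.suc j , descent , refl)          = inj₂ (bottom-prepend⁻ x g descent (below-secondLetter-zero _))
    to′ (Fin.zero  , Fin.zero  , (() , _) , _)
    to′ (Fin.zero  , Fin.suc (Fin.suc _) , (() , _) , _)
    to′ (Fin.suc _ , Fin.zero  , (() , _) , _)
    from′ : w ≡ 1 ⊎ IsBottom g w → IsBottom (prepend x g) w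
    from′ (inj₁ refl)   = Fin.zero , Fin.suc Fin.zero , (refl , punchIn<x x (g Fin.zero) (below-secondLetter-zero _)) , first-value
    from′ (inj₂ bottom) = bottom-prepend⁺ x g bottom (below-secondLetter-zero _)

  -- When g ∈ 𝒞 does not start with 0, prepending the letter g 0 keeps the bottoms:
  -- they all lie below g 0, and the new first pair is an ascent.
  bottoms-prepend-second : ∀ {m} {g : Seq (suc m)} → InCSeq g → ∀ j₀ → g Fin.zero ≡ Fin.suc j₀ → ∀ w →
    IsBottom (prepend (secondLetter (Fin.suc j₀)) g) w ⇔ IsBottom g w
  bottoms-prepend-second {m} {g} inC j₀ g0≡y w = mk⇔ to′ from′
    where
    open Shape inC
    x : Fin (suc (suc m))
    x = secondLetter (Fin.suc j₀)
    x-value : toℕ x ≡ toℕ (g Fin.zero)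
    x-value = trans (toℕ-secondLetter-suc j₀) (sym (cong toℕ g0≡y))
    g0≢0 : g Fin.zero ≢ Fin.zero
    g0≢0 g0≡0 with () ← trans (sym g0≡y) g0≡0
    below-x : ∀ {i j} → Descent g i j → toℕ (g j) < toℕ x
    below-x {j = j} descent = subst (toℕ (g j) <_) (sym x-value) (descent-below-first g0≢0 descent)
    to′ : IsBottom (prepend x g) w → IsBottom g w
    to′ (Fin.zero  , Fin.suc Fin.zero , (_ , drop) , _) = ⊥-elim (<-irrefl (sym x-value) (punchIn<x⁻ x (g Fin.zero) drop))
    to′ (Fin.suc i , Fin.suc j , descent@(j≡i+1 , drop) , refl) =
      bottom-prepend⁻ x g descent (below-x (suc-injective j≡i+1 , punchIn-<⁻ x drop))
    to′ (Fin.zero  , Fin.zero  , (() , _) , _)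
    to′ (Fin.zero  , Fin.suc (Fin.suc _) , (() , _) , _)
    to′ (Fin.suc _ , Fin.zero  , (() , _) , _)
    from′ : IsBottom g w → IsBottom (prepend x g) w
    from′ bottom@(_ , _ , descent , _) = bottom-prepend⁺ x g bottom (below-x descent)

  -- a sequence of 𝒞 not starting with 0 descends into its least letter, so it has bottom value 1
  bottom-one : ∀ {m} {g : Seq (suc m)} → InCSeq g → g Fin.zero ≢ Fin.zero → IsBottom g 1
  bottom-one {g = g} inC g0≢0 with minPos | minPos≢0 g0≢0 | g-minPos | g-minPos<
    where open Shape inC
  ... | Fin.zero  | 0≢p | _      | _   = ⊥-elim (0≢p refl)
  ... | Fin.suc q | _   | gp≡0 | min< =
    inject₁ q , Fin.suc q , (cong suc (sym (toℕ-inject₁ q)) , min< (inject₁ q) q≢q+1) , cong (suc ∘ toℕ) gp≡0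
    where
    q≢q+1 : inject₁ q ≢ Fin.suc q
    q≢q+1 eq = <-irrefl (cong toℕ eq) (subst (_< suc (toℕ q)) (sym (toℕ-inject₁ q)) ≤-refl)

module Recurrence where

  import Data.Integer as ℤ
  open Counting
  open Insertion
  open FirstLetter
  open Statistics
  open import Data.Nat using (ℕ; zero; suc; _+_; _*_; _≤_; _<_; _≟_)
  open import Data.Nat.Properties using (*-identityˡ; *-zeroʳ; +-identityʳ; *-distribˡ-+)
  open import Data.Fin using (Fin; toℕ; fromℕ; punchIn)
  open import Data.Fin.Properties using (punchInᵢ≢i; toℕ≤pred[n]; toℕ-fromℕ) renaming (suc-injective to Fin-suc-injective)
  open import Data.Vec using (Vec; []; _∷_; lookup)
  open import Data.Vec.Properties using (lookup-map)
  open import Data.Product using (_×_; _,_; proj₁; proj₂)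
  open import Data.Sum using (inj₂)
  open import Function using (_∘_)
  open import Relation.Nullary using (¬_; yes; no)
  open import Relation.Nullary.Decidable using (_×-dec_; toWitness)
  open import Relation.Binary.PropositionalEquality

  module _ {m : ℕ} (σ : Word (suc m)) where

    InC-ins⁻ : ∀ x → InC (ins x σ) → InC σ × Admissible x (lookup σ)
    InC-ins⁻ x inC = InCSeq-prepend⁻ x (lookup σ) (InCSeq-≗ (lookup-ins x σ) inC)

    InC-ins⁺ : ∀ x → InC σ → Admissible x (lookup σ) → InC (ins x σ)
    InC-ins⁺ x inC (no-new213 , no-new32-1) =
      InCSeq-≗ (sym ∘ lookup-ins x σ) (InCSeq-prepend⁺ x (lookup σ) inC no-new213 no-new32-1)

    h-ins-zero : h (ins Fin.zero σ) ≡ raise (h σ)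
    h-ins-zero = MaxBottom-unique (h-MaxBottom (ins Fin.zero σ))
      (MaxBottom-≗ (sym ∘ lookup-ins Fin.zero σ) (MaxBottom-raise (h-MaxBottom σ) (bottoms-prepend-zero (lookup σ))))

    h-ins-second : InC σ → h (ins (secondLetter (lookup σ Fin.zero)) σ) ≡ max1 (h σ)
    h-ins-second inC = by-first-letter (lookup σ Fin.zero) refl
      where
      by-first-letter : ∀ y → lookup σ Fin.zero ≡ y → h (ins (secondLetter y) σ) ≡ max1 (h σ)
      by-first-letter Fin.zero σ₀≡0 = MaxBottom-unique (h-MaxBottom (ins (secondLetter Fin.zero) σ))
        (MaxBottom-≗ (sym ∘ lookup-ins _ σ) (MaxBottom-max1 (h-MaxBottom σ) (bottoms-prepend-top (lookup σ) σ₀≡0)))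
      by-first-letter (Fin.suc j₀) σ₀≡y = begin
        h (ins (secondLetter (Fin.suc j₀)) σ)
          ≡⟨ MaxBottom-unique (h-MaxBottom (ins _ σ))
               (MaxBottom-≗ (sym ∘ lookup-ins _ σ) (MaxBottom-same (h-MaxBottom σ) (bottoms-prepend-second inC j₀ σ₀≡y))) ⟩
        h σ
          ≡⟨ max1-≥1 (proj₁ (h-MaxBottom σ) 1 (bottom-one inC σ₀≢0)) ⟨
        max1 (h σ)
          ∎
        where
        open ≡-Reasoning
        σ₀≢0 : lookup σ Fin.zero ≢ Fin.zero
        σ₀≢0 σ₀≡0 with () ← trans (sym σ₀≡y) σ₀≡0

    lastValue-ins : ∀ x → lastValue (ins x σ) ≡ suc (toℕ (punchIn x (lookup σ (fromℕ m))))
    lastValue-ins x = cong (suc ∘ toℕ) (lookup-map (fromℕ m) (punchIn x) σ)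

    -- the last letter of σ lies below the second admissible letter, so it keeps its value
    lastValue-ins-second : InC σ → lastValue (ins (secondLetter (lookup σ Fin.zero)) σ) ≡ lastValue σ
    lastValue-ins-second inC = trans (lastValue-ins x) (cong suc (punchIn-below x (lookup σ (fromℕ m)) below))
      where
      open Shape inC
      x : Fin (suc (suc m))
      x = secondLetter (lookup σ Fin.zero)
      last-below : ∀ y → lookup σ Fin.zero ≡ y → toℕ (lookup σ (fromℕ m)) < toℕ (secondLetter y)
      last-below Fin.zero     _    = below-secondLetter-zero _
      last-below (Fin.suc j₀) σ₀≡y =
        subst (toℕ (lookup σ (fromℕ m)) <_) (trans (cong toℕ σ₀≡y) (sym (toℕ-secondLetter-suc j₀)))
              (below-first-from-min σ₀≢0 (fromℕ m) (subst (toℕ minPos ≤_) (sym (toℕ-fromℕ m)) (toℕ≤pred[n] minPos)))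
        where
        σ₀≢0 : lookup σ Fin.zero ≢ Fin.zero
        σ₀≢0 σ₀≡0 with () ← trans (sym σ₀≡y) σ₀≡0
      below : toℕ (lookup σ (fromℕ m)) < toℕ x
      below = last-below _ refl

  weight : ∀ {m} → (ℕ → ℕ → ℕ) → Word (suc m) → ℕ
  weight p π = indicator (inC? π) * p (h π) (lastValue π)

  weight-∈ : ∀ {m} p (π : Word (suc m)) → InC π → weight p π ≡ p (h π) (lastValue π)
  weight-∈ p π inC = trans (cong (_* p (h π) (lastValue π)) (indicator-yes inC (inC? π))) (*-identityˡ _)

  weight-∉ : ∀ {m} p (π : Word (suc m)) → ¬ InC π → weight p π ≡ 0
  weight-∉ p π ∉𝒞 = cong (_* p (h π) (lastValue π)) (indicator-no ∉𝒞 (inC? π))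

  total : ℕ → (ℕ → ℕ → ℕ) → ℕ
  total m p = listSum (weight p) (words (suc m) (suc m))

  afterZero afterSecond : (ℕ → ℕ → ℕ) → ℕ → ℕ → ℕ
  afterZero   p H L = p (raise H) (suc L)
  afterSecond p H L = p (max1 H) L

  module _ {m : ℕ} (p : ℕ → ℕ → ℕ) (σ : Word (suc m)) where

    extensions-∉ : ¬ InC σ → (∑[ x < suc (suc m) ] weight p (ins x σ)) ≡ 0
    extensions-∉ ∉𝒞 = trans (sum-cong-≗ {suc (suc m)} (λ x → weight-∉ p (ins x σ) (∉𝒞 ∘ proj₁ ∘ InC-ins⁻ σ x)))
                            (sum-replicate-zero (suc (suc m)))

    extensions-∈ : InC σ → (∑[ x < suc (suc m) ] weight p (ins x σ))
                           ≡ afterZero p (h σ) (lastValue σ) + afterSecond p (h σ) (lastValue σ)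
    extensions-∈ inC = begin
      (∑[ x < suc (suc m) ] f x)
        ≡⟨ cong (f Fin.zero +_) (sum-remove {i = s} (f ∘ Fin.suc)) ⟩
      f Fin.zero + (f (Fin.suc s) + rest)
        ≡⟨ cong₂ (λ a b → a + (b + rest)) at-zero at-second ⟩
      afterZero p (h σ) (lastValue σ) + (afterSecond p (h σ) (lastValue σ) + rest)
        ≡⟨ cong (λ r → afterZero p (h σ) (lastValue σ) + (afterSecond p (h σ) (lastValue σ) + r)) others ⟩
      afterZero p (h σ) (lastValue σ) + (afterSecond p (h σ) (lastValue σ) + 0)
        ≡⟨ cong (afterZero p (h σ) (lastValue σ) +_) (+-identityʳ _) ⟩
      afterZero p (h σ) (lastValue σ) + afterSecond p (h σ) (lastValue σ)
        ∎
      where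
      open ≡-Reasoning
      f : Fin (suc (suc m)) → ℕ
      f x = weight p (ins x σ)
      s : Fin (suc m)
      s = predOrTop (lookup σ Fin.zero)
      rest : ℕ
      rest = ∑[ z < m ] f (Fin.suc (punchIn s z))
      at-zero : f Fin.zero ≡ afterZero p (h σ) (lastValue σ)
      at-zero = trans (weight-∈ p (ins Fin.zero σ) (InC-ins⁺ σ Fin.zero inC (zero-admissible (lookup σ))))
                      (cong₂ p (h-ins-zero σ) (lastValue-ins σ Fin.zero))
      at-second : f (Fin.suc s) ≡ afterSecond p (h σ) (lastValue σ)
      at-second = trans (weight-∈ p (ins (Fin.suc s) σ) (InC-ins⁺ σ (Fin.suc s) inC (secondLetter-admissible inC)))
                        (cong₂ p (h-ins-second σ inC) (lastValue-ins-second σ inC))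
      not-admissible : ∀ z → ¬ InC (ins (Fin.suc (punchIn s z)) σ)
      not-admissible z inC′ with admissible-cases inC _ (proj₂ (InC-ins⁻ σ _ inC′))
      ... | inj₂ eq = punchInᵢ≢i s z (Fin-suc-injective eq)
      others : rest ≡ 0
      others = trans (sum-cong-≗ {m} λ z → weight-∉ p (ins (Fin.suc (punchIn s z)) σ) (not-admissible z))
                     (sum-replicate-zero m)

    extensions : (∑[ x < suc (suc m) ] weight p (ins x σ)) ≡ weight (afterZero p) σ + weight (afterSecond p) σ
    extensions with inC? σ
    ... | no ∉𝒞 = trans (extensions-∉ ∉𝒞) (sym (cong₂ _+_ (weight-∉ (afterZero p) σ ∉𝒞) (weight-∉ (afterSecond p) σ ∉𝒞)))
    ... | yes inC = trans (extensions-∈ inC) (sym (cong₂ _+_ (weight-∈ (afterZero p) σ inC) (weight-∈ (afterSecond p) σ inC)))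

  repeated-∉ : ∀ {m} (x : Fin (suc m)) (w : Vec (Fin (suc m)) m) → x occursIn w → ¬ InC (x ∷ w)
  repeated-∉ x w (i , wᵢ≡x) (perm , _) with () ← perm Fin.zero (Fin.suc i) (sym wᵢ≡x)

  -- The insertion recurrence: every π ∈ 𝒞_{m+2} is ins x σ for a unique σ ∈ 𝒞_{m+1}
  -- and one of its two admissible letters x.
  total-suc : ∀ m p → total (suc m) p ≡ total m (afterZero p) + total m (afterSecond p)
  total-suc m p = begin
    listSum (weight p) (words (suc (suc m)) (suc (suc m)))
      ≡⟨ listSum-words (suc (suc m)) (suc m) (weight p) ⟩
    (∑[ x < suc (suc m) ] listSum (weight p ∘ (x ∷_)) (words (suc (suc m)) (suc m)))
      ≡⟨ sum-cong-≗ {suc (suc m)} (λ x → listSum-words-avoiding (suc m) x (weight p ∘ (x ∷_))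
           λ w x∈w → weight-∉ p (x ∷ w) (repeated-∉ x w x∈w)) ⟩
    (∑[ x < suc (suc m) ] listSum (λ σ → weight p (ins x σ)) (words (suc m) (suc m)))
      ≡⟨ ∑-listSum (suc (suc m)) (λ x σ → weight p (ins x σ)) (words (suc m) (suc m)) ⟩
    listSum (λ σ → ∑[ x < suc (suc m) ] weight p (ins x σ)) (words (suc m) (suc m))
      ≡⟨ listSum-cong (extensions p) (words (suc m) (suc m)) ⟩
    listSum (λ σ → weight (afterZero p) σ + weight (afterSecond p) σ) (words (suc m) (suc m))
      ≡⟨ listSum-+ (weight (afterZero p)) (weight (afterSecond p)) (words (suc m) (suc m)) ⟩
    total m (afterZero p) + total m (afterSecond p)
      ∎
    where open ≡-Reasoning

  total-zero : ∀ p → total 0 p ≡ p 0 1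
  total-zero p = trans (+-identityʳ _) (weight-∈ p one (toWitness {a? = inC? one} _))
    where
    one : Word 1
    one = Fin.zero ∷ []

  module _ (m : ℕ) where

    total-cong : ∀ {p q : ℕ → ℕ → ℕ} → (∀ H L → p H L ≡ q H L) → total m p ≡ total m q
    total-cong p≡q = listSum-cong (λ π → cong (indicator (inC? π) *_) (p≡q (h π) (lastValue π))) (words (suc m) (suc m))

    total-+ : ∀ (p q : ℕ → ℕ → ℕ) → total m (λ H L → p H L + q H L) ≡ total m p + total m q
    total-+ p q = trans (listSum-cong (λ π → *-distribˡ-+ (indicator (inC? π)) _ _) (words (suc m) (suc m)))
                        (listSum-+ (weight p) (weight q) (words (suc m) (suc m)))

    total-null : ∀ (p : ℕ → ℕ → ℕ) → (∀ H L → p H L ≡ 0) → total m p ≡ 0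
    total-null p p≡0 = listSum-zero (weight p) (λ π → trans (cong (indicator (inC? π) *_) (p≡0 (h π) (lastValue π)))
                                                            (*-zeroʳ (indicator (inC? π))))
                                    (words (suc m) (suc m))

  count : ℕ → ℕ → ℕ → ℕ
  count m a b = total m (λ H L → δ H a * δ L b)

  N-count : ∀ m a b → N (suc m) a b ≡ ℤ.+ count m a b
  N-count m a b = cong ℤ.+_ (trans (length-filter (counted? a b) (words (suc m) (suc m)))
    (listSum-cong (λ π → trans (indicator-×-dec (inC? π) (h π ≟ a ×-dec lastValue π ≟ b))
                                     (cong (indicator (inC? π) *_) (indicator-×-dec (h π ≟ a) (lastValue π ≟ b))))
                  (words (suc m) (suc m))))

  count-zero : ∀ a b → count 0 a b ≡ δ 0 a * δ 1 b
  count-zero a b = total-zero (λ H L → δ H a * δ L b)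

  -- contributions to count (m+1) a b of the words ins 0 σ (h ↦ raise h, last letter + 1) ...
  fromZero : (ℕ → ℕ → ℕ) → ℕ → ℕ → ℕ
  fromZero q zero          zero    = 0
  fromZero q zero          (suc b) = q 0 b
  fromZero q (suc zero)    b       = 0
  fromZero q (suc (suc a)) zero    = 0
  fromZero q (suc (suc a)) (suc b) = q (suc a) b

  -- ... and of the words ins (secondLetter σ₀) σ (h ↦ max1 h, same last letter)
  fromSecond : (ℕ → ℕ → ℕ) → ℕ → ℕ → ℕ
  fromSecond q zero          b = 0
  fromSecond q (suc zero)    b = q 0 b + q 1 b
  fromSecond q (suc (suc a)) b = q (suc (suc a)) b

  count-suc : ∀ m a b → count (suc m) a b ≡ fromZero (count m) a b + fromSecond (count m) a b
  count-suc m a b = trans (total-suc m (E a b)) (cong₂ _+_ (viaZero a b) (viaSecond a b))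
    where
    E : ℕ → ℕ → ℕ → ℕ → ℕ
    E a b H L = δ H a * δ L b
    viaZero : ∀ a b → total m (afterZero (E a b)) ≡ fromZero (count m) a b
    viaZero zero          zero    = total-null m (afterZero (E 0 0)) (λ H L → *-zeroʳ (δ (raise H) 0))
    viaZero zero          (suc b) =
      total-cong m {afterZero (E 0 (suc b))} {E 0 b} λ { zero L → refl ; (suc H) L → refl }
    viaZero (suc zero)    b       = total-null m (afterZero (E 1 b)) λ { zero L → refl ; (suc H) L → refl }
    viaZero (suc (suc a)) zero    =
      total-null m (afterZero (E (suc (suc a)) 0)) (λ H L → *-zeroʳ (δ (raise H) (suc (suc a))))
    viaZero (suc (suc a)) (suc b) =
      total-cong m {afterZero (E (suc (suc a)) (suc b))} {E (suc a) b} λ { zero L → refl ; (suc H) L → refl }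
    viaSecond : ∀ a b → total m (afterSecond (E a b)) ≡ fromSecond (count m) a b
    viaSecond zero          b = total-null m (afterSecond (E 0 b)) λ { zero L → refl ; (suc H) L → refl }
    viaSecond (suc zero)    b =
      trans (total-cong m {afterSecond (E 1 b)} {λ H L → E 0 b H L + E 1 b H L}
                        λ { zero L → sym (+-identityʳ _) ; (suc H) L → refl })
            (total-+ m (E 0 b) (E 1 b))
    viaSecond (suc (suc a)) b =
      total-cong m {afterSecond (E (suc (suc a)) b)} {E (suc (suc a)) b} λ { zero L → refl ; (suc H) L → refl }

  -- h π = 0 only for the identity permutation, whose last letter is m+1
  count-h0 : ∀ m b → count m 0 b ≡ δ (suc m) b
  count-h0 zero    b       = trans (count-zero 0 b) (+-identityʳ _)
  count-h0 (suc m) zero    = count-suc m 0 0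
  count-h0 (suc m) (suc b) = trans (count-suc m 0 (suc b)) (trans (+-identityʳ _) (count-h0 m b))

module SeriesAlgebra where

  open Counting using (δ; indicator-yes; indicator-no)
  open import Data.Nat as ℕ using (ℕ; zero; suc; _∸_; _≤_; z≤n)
  import Data.Nat.Properties as ℕP
  open import Data.Integer using (ℤ; +_; _+_; _*_; _-_)
  import Data.Integer.Properties as ℤP
  open import Data.Integer.Tactic.RingSolver using (solve-∀)
  open import Algebra.Properties.CommutativeSemigroup ℤP.+-commutativeSemigroup using (interchange)
  open import Relation.Nullary using (yes; no)
  open import Relation.Binary.PropositionalEquality
  open import Relation.Binary.Bundles using (Setoid)
  open import Level using (0ℓ)

  infix 4 _≈_
  _≈_ : Series → Series → Set
  f ≈ g = ∀ n a b → f n a b ≡ g n a b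

  ≈-refl : ∀ {f} → f ≈ f
  ≈-refl n a b = refl

  ≈-setoid : Setoid 0ℓ 0ℓ
  ≈-setoid = record
    { Carrier = Series
    ; _≈_ = _≈_
    ; isEquivalence = record
      { refl = ≈-refl
      ; sym = λ f≈g n a b → sym (f≈g n a b)
      ; trans = λ f≈g g≈h n a b → trans (f≈g n a b) (g≈h n a b)
      }
    }

  ⊕-cong : ∀ {f f′ g g′} → f ≈ f′ → g ≈ g′ → f ⊕ g ≈ f′ ⊕ g′
  ⊕-cong f≈f′ g≈g′ n a b = cong₂ _+_ (f≈f′ n a b) (g≈g′ n a b)

  ⊖-cong : ∀ {f f′ g g′} → f ≈ f′ → g ≈ g′ → f ⊖ g ≈ f′ ⊖ g′
  ⊖-cong f≈f′ g≈g′ n a b = cong₂ _-_ (f≈f′ n a b) (g≈g′ n a b)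

  ⊖-congʳ : ∀ f {g g′} → g ≈ g′ → f ⊖ g ≈ f ⊖ g′
  ⊖-congʳ f = ⊖-cong {f} ≈-refl

  δℤ : ℕ → ℕ → ℤ
  δℤ x y = + δ x y

  mono-δ : ∀ i j k n a b → mono i j k n a b ≡ δℤ n i * δℤ a j * δℤ b k
  mono-δ i j k n a b with n ℕ.≟ i | a ℕ.≟ j | b ℕ.≟ k
  ... | yes n≡i | yes a≡j | yes b≡k = sym (cong₂ _*_ (cong₂ _*_ (δℤ-yes n≡i) (δℤ-yes a≡j)) (δℤ-yes b≡k))
    where δℤ-yes : ∀ {x y} → x ≡ y → δℤ x y ≡ + 1
          δℤ-yes {x} {y} x≡y = cong +_ (indicator-yes x≡y (x ℕ.≟ y))
  ... | no n≢i  | _       | _       = sym (cong (λ d → d * δℤ a j * δℤ b k) (cong +_ (indicator-no n≢i (n ℕ.≟ i))))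
  ... | yes _   | no a≢j  | _       = sym (trans (cong (λ d → δℤ n i * d * δℤ b k) (cong +_ (indicator-no a≢j (a ℕ.≟ j))))
                                                 (cong (_* δℤ b k) (ℤP.*-zeroʳ (δℤ n i))))
  ... | yes _   | yes _   | no b≢k  = sym (trans (cong (δℤ n i * δℤ a j *_) (cong +_ (indicator-no b≢k (b ℕ.≟ k))))
                                                 (ℤP.*-zeroʳ (δℤ n i * δℤ a j)))

  Σ≤-cong : ∀ n {f g : ℕ → ℤ} → (∀ m → m ≤ n → f m ≡ g m) → Σ≤ n f ≡ Σ≤ n g
  Σ≤-cong zero    f≡g = f≡g 0 z≤n
  Σ≤-cong (suc n) f≡g = cong₂ _+_ (Σ≤-cong n (λ m m≤n → f≡g m (ℕP.m≤n⇒m≤1+n m≤n))) (f≡g (suc n) ℕP.≤-refl)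

  Σ≤-cong′ : ∀ n {f g : ℕ → ℤ} → (∀ m → f m ≡ g m) → Σ≤ n f ≡ Σ≤ n g
  Σ≤-cong′ n f≡g = Σ≤-cong n (λ m _ → f≡g m)

  Σ≤-zero : ∀ n (f : ℕ → ℤ) → (∀ m → f m ≡ + 0) → Σ≤ n f ≡ + 0
  Σ≤-zero zero    f f≡0 = f≡0 0
  Σ≤-zero (suc n) f f≡0 = cong₂ _+_ (Σ≤-zero n f f≡0) (f≡0 (suc n))

  Σ≤-+ : ∀ n (f g : ℕ → ℤ) → Σ≤ n (λ m → f m + g m) ≡ Σ≤ n f + Σ≤ n g
  Σ≤-+ zero    f g = refl
  Σ≤-+ (suc n) f g = trans (cong (_+ (f (suc n) + g (suc n))) (Σ≤-+ n f g)) (interchange (Σ≤ n f) (Σ≤ n g) (f (suc n)) (g (suc n)))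

  Σ≤-- : ∀ n (f g : ℕ → ℤ) → Σ≤ n (λ m → f m - g m) ≡ Σ≤ n f - Σ≤ n g
  Σ≤-- zero    f g = refl
  Σ≤-- (suc n) f g = trans (cong (_+ (f (suc n) - g (suc n))) (Σ≤-- n f g)) (regroup (Σ≤ n f) (Σ≤ n g) (f (suc n)) (g (suc n)))
    where regroup : ∀ a b c d → (a - b) + (c - d) ≡ (a + c) - (b + d)
          regroup = solve-∀

  Σ≤-*ʳ : ∀ n (f : ℕ → ℤ) c → Σ≤ n (λ m → f m * c) ≡ Σ≤ n f * c
  Σ≤-*ʳ zero    f c = refl
  Σ≤-*ʳ (suc n) f c = trans (cong (_+ (f (suc n) * c)) (Σ≤-*ʳ n f c)) (sym (ℤP.*-distribʳ-+ c (Σ≤ n f) (f (suc n))))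

  sh : ℕ → (ℕ → ℤ) → ℕ → ℤ
  sh zero    F n       = F n
  sh (suc i) F zero    = + 0
  sh (suc i) F (suc n) = sh i F n

  Σδ : ∀ n i (F : ℕ → ℤ) → Σ≤ n (λ m → F m * δℤ (n ∸ m) i) ≡ sh i F n
  Σδ zero    zero    F = ℤP.*-identityʳ (F 0)
  Σδ zero    (suc i) F = ℤP.*-zeroʳ (F 0)
  Σδ (suc n) i       F = begin
    Σ≤ n (λ m → F m * δℤ (suc n ∸ m) i) + F (suc n) * δℤ (suc n ∸ suc n) i
      ≡⟨ cong₂ _+_ (Σ≤-cong n (λ m m≤n → cong (λ d → F m * δℤ d i) (ℕP.+-∸-assoc 1 m≤n)))
                   (cong (λ d → F (suc n) * δℤ d i) (ℕP.n∸n≡0 n)) ⟩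
    Σ≤ n (λ m → F m * δℤ (suc (n ∸ m)) i) + F (suc n) * δℤ 0 i
      ≡⟨ last-or-earlier i ⟩
    sh i F (suc n)
      ∎
    where
    open ≡-Reasoning
    last-or-earlier : ∀ i → Σ≤ n (λ m → F m * δℤ (suc (n ∸ m)) i) + F (suc n) * δℤ 0 i ≡ sh i F (suc n)
    last-or-earlier zero = trans (cong₂ _+_ (Σ≤-zero n _ (λ m → ℤP.*-zeroʳ (F m))) (ℤP.*-identityʳ (F (suc n))))
                                 (ℤP.+-identityˡ _)
    last-or-earlier (suc i) = trans (cong₂ _+_ (Σδ n i F) (ℤP.*-zeroʳ (F (suc n)))) (ℤP.+-identityʳ _)

  sh-cong : ∀ i {F G : ℕ → ℤ} → (∀ m → F m ≡ G m) → ∀ n → sh i F n ≡ sh i G n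
  sh-cong zero    F≡G n       = F≡G n
  sh-cong (suc i) F≡G zero    = refl
  sh-cong (suc i) F≡G (suc n) = sh-cong i F≡G n

  sh-- : ∀ i (F G : ℕ → ℤ) n → sh i (λ m → F m - G m) n ≡ sh i F n - sh i G n
  sh-- zero    F G n       = refl
  sh-- (suc i) F G zero    = refl
  sh-- (suc i) F G (suc n) = sh-- i F G n

  sh-*ʳ : ∀ i (F : ℕ → ℤ) c n → sh i (λ m → F m * c) n ≡ sh i F n * c
  sh-*ʳ zero    F c n       = refl
  sh-*ʳ (suc i) F c zero    = refl
  sh-*ʳ (suc i) F c (suc n) = sh-*ʳ i F c n

  sh-*ˡ : ∀ i (F : ℕ → ℤ) c n → sh i (λ m → c * F m) n ≡ c * sh i F n
  sh-*ˡ zero    F c n       = refl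
  sh-*ˡ (suc i) F c zero    = sym (ℤP.*-zeroʳ c)
  sh-*ˡ (suc i) F c (suc n) = sh-*ˡ i F c n

  sh-δ : ∀ i i′ n → sh i (λ m → δℤ m i′) n ≡ δℤ n (i ℕ.+ i′)
  sh-δ zero    i′ n       = refl
  sh-δ (suc i) i′ zero    = refl
  sh-δ (suc i) i′ (suc n) = sh-δ i i′ n

  sh-zero : ∀ i n → sh i (λ _ → + 0) n ≡ + 0
  sh-zero zero    n       = refl
  sh-zero (suc i) zero    = refl
  sh-zero (suc i) (suc n) = sh-zero i n

  sh-sh : ∀ i i′ (F : ℕ → ℤ) n → sh i (sh i′ F) n ≡ sh (i ℕ.+ i′) F n
  sh-sh zero    i′ F n       = refl
  sh-sh (suc i) i′ F zero    = refl
  sh-sh (suc i) i′ F (suc n) = sh-sh i i′ F n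

  sh-comm : ∀ i j (F : ℕ → ℕ → ℤ) x y → sh i (λ x′ → sh j (F x′) y) x ≡ sh j (λ y′ → sh i (λ x′ → F x′ y′) x) y
  sh-comm zero    j F x       y = refl
  sh-comm (suc i) j F zero    y = sym (sh-zero j y)
  sh-comm (suc i) j F (suc x) y = sh-comm i j F x y

  -- Multiplication by t^i u^j v^k shifts the coefficients.
  Sh : ℕ → ℕ → ℕ → Series → Series
  Sh i j k f n a b = sh i (λ n₁ → sh j (λ a₁ → sh k (λ b₁ → f n₁ a₁ b₁) b) a) n

  Sh-cong : ∀ i j k {f g : Series} → f ≈ g → Sh i j k f ≈ Sh i j k g
  Sh-cong i j k f≈g n a b = sh-cong i (λ n₁ → sh-cong j (λ a₁ → sh-cong k (λ b₁ → f≈g n₁ a₁ b₁) b) a) n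

  Sh-⊖ : ∀ i j k (f g : Series) → Sh i j k (f ⊖ g) ≈ Sh i j k f ⊖ Sh i j k g
  Sh-⊖ i j k f g n a b =
    trans (sh-cong i (λ n₁ → trans (sh-cong j (λ a₁ → sh-- k (f n₁ a₁) (g n₁ a₁) b) a) (sh-- j _ _ a)) n) (sh-- i _ _ n)

  Sh-Sh : ∀ i j k i′ j′ k′ (f : Series) → Sh i j k (Sh i′ j′ k′ f) ≈ Sh (i ℕ.+ i′) (j ℕ.+ j′) (k ℕ.+ k′) f
  Sh-Sh i j k i′ j′ k′ f n a b = begin
    sh i (λ n₁ → sh j (λ a₁ → sh k (λ b₁ → sh i′ (λ n₂ → sh j′ (λ a₂ → sh k′ (f n₂ a₂) b₁) a₁) n₁) b) a) n
      ≡⟨ sh-cong i (λ n₁ → trans (sh-cong j (λ a₁ → sh-comm k i′ _ b n₁) a) (sh-comm j i′ _ a n₁)) n ⟩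
    sh i (sh i′ (λ n₂ → sh j (λ a₁ → sh k (λ b₁ → sh j′ (λ a₂ → sh k′ (f n₂ a₂) b₁) a₁) b) a)) n
      ≡⟨ sh-sh i i′ _ n ⟩
    sh (i ℕ.+ i′) (λ n₂ → sh j (λ a₁ → sh k (λ b₁ → sh j′ (λ a₂ → sh k′ (f n₂ a₂) b₁) a₁) b) a) n
      ≡⟨ sh-cong (i ℕ.+ i′) (λ n₂ → trans (sh-cong j (λ a₁ → sh-comm k j′ _ b a₁) a) (sh-sh j j′ _ a)) n ⟩
    sh (i ℕ.+ i′) (λ n₂ → sh (j ℕ.+ j′) (λ a₂ → sh k (sh k′ (f n₂ a₂)) b) a) n
      ≡⟨ sh-cong (i ℕ.+ i′) (λ n₂ → sh-cong (j ℕ.+ j′) (λ a₂ → sh-sh k k′ _ b) a) n ⟩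
    Sh (i ℕ.+ i′) (j ℕ.+ j′) (k ℕ.+ k′) f n a b
      ∎
    where open ≡-Reasoning

  Sh-mono : ∀ i j k i′ j′ k′ → Sh i j k (mono i′ j′ k′) ≈ mono (i ℕ.+ i′) (j ℕ.+ j′) (k ℕ.+ k′)
  Sh-mono i j k i′ j′ k′ n a b = begin
    sh i (λ n₁ → sh j (λ a₁ → sh k (λ b₁ → mono i′ j′ k′ n₁ a₁ b₁) b) a) n
      ≡⟨ sh-cong i (λ n₁ → sh-cong j (λ a₁ → sh-cong k (λ b₁ → mono-δ i′ j′ k′ n₁ a₁ b₁) b) a) n ⟩
    sh i (λ n₁ → sh j (λ a₁ → sh k (λ b₁ → δℤ n₁ i′ * δℤ a₁ j′ * δℤ b₁ k′) b) a) n
      ≡⟨ sh-cong i (λ n₁ → sh-cong j (λ a₁ → trans (sh-*ˡ k (λ b₁ → δℤ b₁ k′) (δℤ n₁ i′ * δℤ a₁ j′) b)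
                                                    (cong (δℤ n₁ i′ * δℤ a₁ j′ *_) (sh-δ k k′ b))) a) n ⟩
    sh i (λ n₁ → sh j (λ a₁ → δℤ n₁ i′ * δℤ a₁ j′ * δℤ b (k ℕ.+ k′)) a) n
      ≡⟨ sh-cong i (λ n₁ → trans (sh-*ʳ j (λ a₁ → δℤ n₁ i′ * δℤ a₁ j′) _ a)
                                (cong (_* δℤ b (k ℕ.+ k′)) (trans (sh-*ˡ j (λ a₁ → δℤ a₁ j′) (δℤ n₁ i′) a)
                                                                 (cong (δℤ n₁ i′ *_) (sh-δ j j′ a))))) n ⟩
    sh i (λ n₁ → δℤ n₁ i′ * δℤ a (j ℕ.+ j′) * δℤ b (k ℕ.+ k′)) n
      ≡⟨ trans (sh-*ʳ i (λ n₁ → δℤ n₁ i′ * δℤ a (j ℕ.+ j′)) _ n)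
               (cong (_* δℤ b (k ℕ.+ k′)) (trans (sh-*ʳ i (λ n₁ → δℤ n₁ i′) _ n) (cong (_* δℤ a (j ℕ.+ j′)) (sh-δ i i′ n)))) ⟩
    δℤ n (i ℕ.+ i′) * δℤ a (j ℕ.+ j′) * δℤ b (k ℕ.+ k′)
      ≡⟨ mono-δ _ _ _ n a b ⟨
    mono (i ℕ.+ i′) (j ℕ.+ j′) (k ℕ.+ k′) n a b
      ∎
    where open ≡-Reasoning

  ⊛-congʳ : ∀ f {g g′} → g ≈ g′ → f ⊛ g ≈ f ⊛ g′
  ⊛-congʳ f g≈g′ n a b = Σ≤-cong′ n λ n₁ → Σ≤-cong′ a λ a₁ → Σ≤-cong′ b λ b₁ →
    cong (f n₁ a₁ b₁ *_) (g≈g′ (n ∸ n₁) (a ∸ a₁) (b ∸ b₁))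

  ⊛-⊕ : ∀ f g h → f ⊛ (g ⊕ h) ≈ f ⊛ g ⊕ f ⊛ h
  ⊛-⊕ f g h n a b =
    trans (Σ≤-cong′ n λ n₁ → trans (Σ≤-cong′ a λ a₁ →
             trans (Σ≤-cong′ b λ b₁ → ℤP.*-distribˡ-+ (f n₁ a₁ b₁) _ _) (Σ≤-+ b _ _)) (Σ≤-+ a _ _))
          (Σ≤-+ n _ _)

  ⊛-⊖ : ∀ f g h → f ⊛ (g ⊖ h) ≈ f ⊛ g ⊖ f ⊛ h
  ⊛-⊖ f g h n a b =
    trans (Σ≤-cong′ n λ n₁ → trans (Σ≤-cong′ a λ a₁ →
             trans (Σ≤-cong′ b λ b₁ → distrib (f n₁ a₁ b₁) _ _) (Σ≤-- b _ _)) (Σ≤-- a _ _))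
          (Σ≤-- n _ _)
    where distrib : ∀ x y z → x * (y - z) ≡ x * y - x * z
          distrib = solve-∀

  ⊛-congˡ : ∀ {f f′} g → f ≈ f′ → f ⊛ g ≈ f′ ⊛ g
  ⊛-congˡ g f≈f′ n a b = Σ≤-cong′ n λ n₁ → Σ≤-cong′ a λ a₁ → Σ≤-cong′ b λ b₁ →
    cong (_* g (n ∸ n₁) (a ∸ a₁) (b ∸ b₁)) (f≈f′ n₁ a₁ b₁)

  ⊛-mono : ∀ f i j k → f ⊛ mono i j k ≈ Sh i j k f
  ⊛-mono f i j k n a b = begin
    Σ≤ n (λ n₁ → Σ≤ a (λ a₁ → Σ≤ b (λ b₁ → f n₁ a₁ b₁ * mono i j k (n ∸ n₁) (a ∸ a₁) (b ∸ b₁))))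
      ≡⟨ Σ≤-cong′ n (λ n₁ → Σ≤-cong′ a λ a₁ → trans (Σ≤-cong′ b λ b₁ → split n₁ a₁ b₁)
                                                    (Σ≤-*ʳ b (λ b₁ → f n₁ a₁ b₁ * δℤ (b ∸ b₁) k) _)) ⟩
    Σ≤ n (λ n₁ → Σ≤ a (λ a₁ → Σ≤ b (λ b₁ → f n₁ a₁ b₁ * δℤ (b ∸ b₁) k) * (δℤ (a ∸ a₁) j * δℤ (n ∸ n₁) i)))
      ≡⟨ Σ≤-cong′ n (λ n₁ → Σ≤-cong′ a λ a₁ → trans (cong (_* (δℤ (a ∸ a₁) j * δℤ (n ∸ n₁) i)) (Σδ b k (f n₁ a₁)))
                                                    (sym (ℤP.*-assoc (sh k (f n₁ a₁) b) (δℤ (a ∸ a₁) j) (δℤ (n ∸ n₁) i)))) ⟩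
    Σ≤ n (λ n₁ → Σ≤ a (λ a₁ → sh k (f n₁ a₁) b * δℤ (a ∸ a₁) j * δℤ (n ∸ n₁) i))
      ≡⟨ Σ≤-cong′ n (λ n₁ → trans (Σ≤-*ʳ a (λ a₁ → sh k (f n₁ a₁) b * δℤ (a ∸ a₁) j) _)
                                 (cong (_* δℤ (n ∸ n₁) i) (Σδ a j (λ a₁ → sh k (f n₁ a₁) b)))) ⟩
    Σ≤ n (λ n₁ → sh j (λ a₁ → sh k (f n₁ a₁) b) a * δℤ (n ∸ n₁) i)
      ≡⟨ Σδ n i (λ n₁ → sh j (λ a₁ → sh k (f n₁ a₁) b) a) ⟩
    Sh i j k f n a b
      ∎
    where
    open ≡-Reasoning
    rearrange : ∀ x p q r → x * (p * q * r) ≡ x * r * (q * p)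
    rearrange = solve-∀
    split : ∀ n₁ a₁ b₁ → f n₁ a₁ b₁ * mono i j k (n ∸ n₁) (a ∸ a₁) (b ∸ b₁)
                       ≡ f n₁ a₁ b₁ * δℤ (b ∸ b₁) k * (δℤ (a ∸ a₁) j * δℤ (n ∸ n₁) i)
    split n₁ a₁ b₁ = trans (cong (f n₁ a₁ b₁ *_) (mono-δ i j k _ _ _))
                           (rearrange (f n₁ a₁ b₁) (δℤ (n ∸ n₁) i) (δℤ (a ∸ a₁) j) (δℤ (b ∸ b₁) k))

module GeneratingFunction where

  open Counting using (δ)
  open Recurrence using (count; count-zero; count-suc; count-h0; N-count)
  open SeriesAlgebra
  open import Data.Nat as ℕ using (zero; suc)
  open import Data.Integer using (+_; _+_; _-_; _*_)
  import Data.Integer.Properties as ℤP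
  open import Data.Integer.Tactic.RingSolver using (solve-∀)
  open import Relation.Binary.PropositionalEquality using (_≡_; refl; cong; cong₂; trans)
  open import Relation.Binary.Reasoning.Setoid ≈-setoid

  tv≈ : t ⊛ v ≈ mono 1 0 1
  tv≈ = begin
    t ⊛ mono 0 0 1   ≈⟨ ⊛-mono t 0 0 1 ⟩
    Sh 0 0 1 t       ≈⟨ Sh-mono 0 0 1 1 0 0 ⟩
    mono 1 0 1       ∎

  tu≈ : t ⊛ u ≈ mono 1 1 0
  tu≈ = begin
    t ⊛ mono 0 1 0   ≈⟨ ⊛-mono t 0 1 0 ⟩
    Sh 0 1 0 t       ≈⟨ Sh-mono 0 1 0 1 0 0 ⟩
    mono 1 1 0       ∎

  tuv≈ : t ⊛ u ⊛ v ≈ mono 1 1 1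
  tuv≈ = begin
    t ⊛ u ⊛ mono 0 0 1   ≈⟨ ⊛-mono (t ⊛ u) 0 0 1 ⟩
    Sh 0 0 1 (t ⊛ u)     ≈⟨ Sh-cong 0 0 1 tu≈ ⟩
    Sh 0 0 1 (mono 1 1 0) ≈⟨ Sh-mono 0 0 1 1 1 0 ⟩
    mono 1 1 1           ∎

  A B : Series
  A = 𝟙 ⊖ t ⊛ v
  B = 𝟙 ⊖ t ⊖ t ⊛ u ⊛ v

  ⊛-A : ∀ f → f ⊛ A ≈ f ⊖ Sh 1 0 1 f
  ⊛-A f = begin
    f ⊛ (𝟙 ⊖ t ⊛ v)          ≈⟨ ⊛-⊖ f 𝟙 (t ⊛ v) ⟩
    f ⊛ 𝟙 ⊖ f ⊛ (t ⊛ v)      ≈⟨ ⊖-cong (⊛-mono f 0 0 0) (⊛-congʳ f tv≈) ⟩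
    f ⊖ f ⊛ mono 1 0 1       ≈⟨ ⊖-congʳ f (⊛-mono f 1 0 1) ⟩
    f ⊖ Sh 1 0 1 f           ∎

  ⊛-B : ∀ f → f ⊛ B ≈ f ⊖ Sh 1 0 0 f ⊖ Sh 1 1 1 f
  ⊛-B f = begin
    f ⊛ (𝟙 ⊖ t ⊖ t ⊛ u ⊛ v)                ≈⟨ ⊛-⊖ f (𝟙 ⊖ t) (t ⊛ u ⊛ v) ⟩
    f ⊛ (𝟙 ⊖ t) ⊖ f ⊛ (t ⊛ u ⊛ v)          ≈⟨ ⊖-cong (⊛-⊖ f 𝟙 t) (⊛-congʳ f tuv≈) ⟩
    f ⊛ 𝟙 ⊖ f ⊛ t ⊖ f ⊛ mono 1 1 1         ≈⟨ ⊖-cong (⊖-cong (⊛-mono f 0 0 0) (⊛-mono f 1 0 0)) (⊛-mono f 1 1 1) ⟩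
    f ⊖ Sh 1 0 0 f ⊖ Sh 1 1 1 f            ∎

  Sh-A : ∀ i j k → Sh i j k A ≈ mono (i ℕ.+ 0) (j ℕ.+ 0) (k ℕ.+ 0) ⊖ mono (i ℕ.+ 1) (j ℕ.+ 0) (k ℕ.+ 1)
  Sh-A i j k = begin
    Sh i j k (𝟙 ⊖ t ⊛ v)                     ≈⟨ Sh-cong i j k (⊖-congʳ 𝟙 tv≈) ⟩
    Sh i j k (mono 0 0 0 ⊖ mono 1 0 1)        ≈⟨ Sh-⊖ i j k (mono 0 0 0) (mono 1 0 1) ⟩
    Sh i j k (mono 0 0 0) ⊖ Sh i j k (mono 1 0 1)
                                             ≈⟨ ⊖-cong (Sh-mono i j k 0 0 0) (Sh-mono i j k 1 0 1) ⟩
    mono (i ℕ.+ 0) (j ℕ.+ 0) (k ℕ.+ 0) ⊖ mono (i ℕ.+ 1) (j ℕ.+ 0) (k ℕ.+ 1)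
                                             ∎

  P₁ P₂ P₃ : Series
  P₁ = mono 0 0 0 ⊖ mono 1 0 1
  P₂ = mono 1 0 0 ⊖ mono 2 0 1
  P₃ = mono 1 1 1 ⊖ mono 2 1 2

  AB≈ : A ⊛ B ≈ P₁ ⊖ P₂ ⊖ P₃
  AB≈ = begin
    A ⊛ B                                    ≈⟨ ⊛-B A ⟩
    A ⊖ Sh 1 0 0 A ⊖ Sh 1 1 1 A              ≈⟨ ⊖-cong (⊖-cong (Sh-A 0 0 0) (Sh-A 1 0 0)) (Sh-A 1 1 1) ⟩
    P₁ ⊖ P₂ ⊖ P₃                             ∎

  ⊛-binomial : ∀ f i j k i′ j′ k′ → f ⊛ (mono i j k ⊖ mono i′ j′ k′) ≈ Sh i j k f ⊖ Sh i′ j′ k′ f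
  ⊛-binomial f i j k i′ j′ k′ = begin
    f ⊛ (mono i j k ⊖ mono i′ j′ k′)         ≈⟨ ⊛-⊖ f (mono i j k) (mono i′ j′ k′) ⟩
    f ⊛ mono i j k ⊖ f ⊛ mono i′ j′ k′       ≈⟨ ⊖-cong (⊛-mono f i j k) (⊛-mono f i′ j′ k′) ⟩
    Sh i j k f ⊖ Sh i′ j′ k′ f               ∎

  ⊛-denominator : ∀ f → f ⊛ (A ⊛ B) ≈ (f ⊛ B) ⊛ A
  ⊛-denominator f = begin
    f ⊛ (A ⊛ B)
      ≈⟨ ⊛-congʳ f AB≈ ⟩
    f ⊛ (P₁ ⊖ P₂ ⊖ P₃)
      ≈⟨ ⊛-⊖ f (P₁ ⊖ P₂) P₃ ⟩
    f ⊛ (P₁ ⊖ P₂) ⊖ f ⊛ P₃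
      ≈⟨ ⊖-cong (⊛-⊖ f P₁ P₂) (⊛-binomial f 1 1 1 2 1 2) ⟩
    f ⊛ P₁ ⊖ f ⊛ P₂ ⊖ (Sh 1 1 1 f ⊖ Sh 2 1 2 f)
      ≈⟨ ⊖-cong (⊖-cong (⊛-binomial f 0 0 0 1 0 1) (⊛-binomial f 1 0 0 2 0 1)) (≈-refl {Sh 1 1 1 f ⊖ Sh 2 1 2 f}) ⟩
    (f ⊖ Sh 1 0 1 f) ⊖ (Sh 1 0 0 f ⊖ Sh 2 0 1 f) ⊖ (Sh 1 1 1 f ⊖ Sh 2 1 2 f)
      ≈⟨ (λ n a b → regroup (f n a b) (Sh 1 0 1 f n a b) (Sh 1 0 0 f n a b) (Sh 2 0 1 f n a b)
                            (Sh 1 1 1 f n a b) (Sh 2 1 2 f n a b)) ⟩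
    (f ⊖ Sh 1 0 0 f ⊖ Sh 1 1 1 f) ⊖ (Sh 1 0 1 f ⊖ Sh 2 0 1 f ⊖ Sh 2 1 2 f)
      ≈⟨ ⊖-congʳ (f ⊖ Sh 1 0 0 f ⊖ Sh 1 1 1 f)
           (⊖-cong (⊖-congʳ (Sh 1 0 1 f) (Sh-Sh 1 0 1 1 0 0 f)) (Sh-Sh 1 0 1 1 1 1 f)) ⟨
    (f ⊖ Sh 1 0 0 f ⊖ Sh 1 1 1 f) ⊖ (Sh 1 0 1 f ⊖ Sh 1 0 1 (Sh 1 0 0 f) ⊖ Sh 1 0 1 (Sh 1 1 1 f))
      ≈⟨ ⊖-congʳ (f ⊖ Sh 1 0 0 f ⊖ Sh 1 1 1 f)
           (λ n a b → trans (Sh-⊖ 1 0 1 (f ⊖ Sh 1 0 0 f) (Sh 1 1 1 f) n a b)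
                            (cong (_- Sh 1 0 1 (Sh 1 1 1 f) n a b) (Sh-⊖ 1 0 1 f (Sh 1 0 0 f) n a b))) ⟨
    (f ⊖ Sh 1 0 0 f ⊖ Sh 1 1 1 f) ⊖ Sh 1 0 1 (f ⊖ Sh 1 0 0 f ⊖ Sh 1 1 1 f)
      ≈⟨ ⊖-cong (⊛-B f) (Sh-cong 1 0 1 (⊛-B f)) ⟨
    f ⊛ B ⊖ Sh 1 0 1 (f ⊛ B)
      ≈⟨ ⊛-A (f ⊛ B) ⟨
    (f ⊛ B) ⊛ A
      ∎
    where
    regroup : ∀ a b c d e g → (a - b) - (c - d) - (e - g) ≡ (a - c - e) - (b - d - g)
    regroup = solve-∀

  -- The coefficients of N (1 - t - tuv), i.e. of  tv + Σ_{n ≥ 2} tⁿ vⁿ⁻¹ (v - 1) (1 - u).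
  NB : Series
  NB zero          a             b = + 0
  NB (suc zero)    a             b = + (δ 0 a ℕ.* δ 1 b)
  NB (suc (suc k)) zero          b = δℤ (suc (suc k)) b - δℤ (suc k) b
  NB (suc (suc k)) (suc zero)    b = δℤ (suc k) b - δℤ (suc (suc k)) b
  NB (suc (suc k)) (suc (suc a)) b = + 0

  -- The insertion recurrence makes N (1 - t - tuv) this simple: the words ins 0 σ with
  -- h ≥ 2 cancel against - tuv N, the words ins (secondLetter σ₀) σ with h ≥ 2 against - t N.
  N⊛B≈NB : N ⊛ B ≈ NB
  N⊛B≈NB = begin
    N ⊛ B                          ≈⟨ ⊛-B N ⟩
    N ⊖ Sh 1 0 0 N ⊖ Sh 1 1 1 N    ≈⟨ coefficient ⟩
    NB                             ∎
    where
    x-0-0 : ∀ x → x - + 0 - + 0 ≡ x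
    x-0-0 x = trans (ℤP.+-identityʳ _) (ℤP.+-identityʳ x)
    cancel : ∀ x y z → (x + y) - y - z ≡ x - z
    cancel = solve-∀
    cancel₀ : ∀ x y → (x + y) - y - x ≡ + 0
    cancel₀ = solve-∀
    coefficient : ∀ n a b → (N ⊖ Sh 1 0 0 N ⊖ Sh 1 1 1 N) n a b ≡ NB n a b
    coefficient zero a b = refl
    coefficient (suc zero) a b = trans (cong₂ (λ x y → x - + 0 - y) (trans (N-count 0 a b) (cong +_ (count-zero a b)))
                                              (trans (sh-cong 1 (λ a₁ → sh-zero 1 b) a) (sh-zero 1 a)))
                                       (x-0-0 _)
    coefficient (suc (suc k)) zero b =
      trans (cong₂ (λ x y → x - y - + 0) (trans (N-count (suc k) 0 b) (cong +_ (count-h0 (suc k) b)))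
                                          (trans (N-count k 0 b) (cong +_ (count-h0 k b))))
            (ℤP.+-identityʳ _)
    coefficient (suc (suc k)) (suc zero) b =
      trans (cong₂ _-_ (cong₂ _-_ (trans (N-count (suc k) 1 b) (cong +_ (count-suc k 1 b))) (N-count k 1 b))
                       (trans (sh-cong 1 (λ b₁ → N-count k 0 b₁) b) (last-below b)))
            (trans (cancel (+ count k 0 b) (+ count k 1 b) _) (cong (λ c → + c - δℤ (suc (suc k)) b) (count-h0 k b)))
      where
      last-below : ∀ b → sh 1 (λ b₁ → + count k 0 b₁) b ≡ δℤ (suc (suc k)) b
      last-below zero    = refl
      last-below (suc b) = cong +_ (count-h0 k b)
    coefficient (suc (suc k)) (suc (suc a)) zero =
      trans (cong₂ (λ x y → x - y - + 0) (trans (N-count (suc k) (suc (suc a)) 0) (cong +_ (count-suc k _ 0)))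
                                          (N-count k (suc (suc a)) 0))
            (trans (ℤP.+-identityʳ _) (ℤP.+-inverseʳ (+ count k (suc (suc a)) 0)))
    coefficient (suc (suc k)) (suc (suc a)) (suc b) =
      trans (cong₂ _-_ (cong₂ _-_ (trans (N-count (suc k) (suc (suc a)) (suc b)) (cong +_ (count-suc k _ (suc b))))
                                  (N-count k (suc (suc a)) (suc b)))
                       (N-count k (suc a) b))
            (cancel₀ (+ count k (suc a) b) (+ count k (suc (suc a)) (suc b)))

  numerator : Series
  numerator = mono 1 0 1 ⊖ mono 2 0 1 ⊕ mono 2 1 1 ⊖ mono 2 1 2

  numerator≈ : t ⊛ v ⊛ (𝟙 ⊖ t ⊕ t ⊛ u ⊖ t ⊛ u ⊛ v) ≈ numerator
  numerator≈ = begin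
    tv ⊛ (𝟙 ⊖ t ⊕ t ⊛ u ⊖ t ⊛ u ⊛ v)
      ≈⟨ ⊛-⊖ tv (𝟙 ⊖ t ⊕ t ⊛ u) (t ⊛ u ⊛ v) ⟩
    tv ⊛ (𝟙 ⊖ t ⊕ t ⊛ u) ⊖ tv ⊛ (t ⊛ u ⊛ v)
      ≈⟨ ⊖-cong (⊛-⊕ tv (𝟙 ⊖ t) (t ⊛ u)) (⊛-congʳ tv tuv≈) ⟩
    tv ⊛ (𝟙 ⊖ t) ⊕ tv ⊛ (t ⊛ u) ⊖ tv ⊛ mono 1 1 1
      ≈⟨ ⊖-cong (⊕-cong (⊛-⊖ tv 𝟙 t) (⊛-congʳ tv tu≈)) (⊛-mono tv 1 1 1) ⟩
    tv ⊛ 𝟙 ⊖ tv ⊛ t ⊕ tv ⊛ mono 1 1 0 ⊖ Sh 1 1 1 tv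
      ≈⟨ ⊖-cong (⊕-cong (⊖-cong (⊛-mono tv 0 0 0) (⊛-mono tv 1 0 0)) (⊛-mono tv 1 1 0)) ≈-refl ⟩
    Sh 0 0 0 tv ⊖ Sh 1 0 0 tv ⊕ Sh 1 1 0 tv ⊖ Sh 1 1 1 tv
      ≈⟨ ⊖-cong (⊕-cong (⊖-cong (shifted 0 0 0) (shifted 1 0 0)) (shifted 1 1 0)) (shifted 1 1 1) ⟩
    numerator
      ∎
    where
    tv : Series
    tv = t ⊛ v
    shifted : ∀ i j k → Sh i j k tv ≈ mono (i ℕ.+ 1) (j ℕ.+ 0) (k ℕ.+ 1)
    shifted i j k = begin
      Sh i j k tv           ≈⟨ Sh-cong i j k tv≈ ⟩
      Sh i j k (mono 1 0 1) ≈⟨ Sh-mono i j k 1 0 1 ⟩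
      mono (i ℕ.+ 1) (j ℕ.+ 0) (k ℕ.+ 1) ∎

  NB⊛A≈numerator : NB ⊛ A ≈ numerator
  NB⊛A≈numerator = begin
    NB ⊛ A                  ≈⟨ ⊛-A NB ⟩
    NB ⊖ Sh 1 0 1 NB        ≈⟨ coefficient ⟩
    numerator-δ             ≈⟨ (λ n a b → cong₂ _-_ (cong₂ _+_ (cong₂ _-_ (mono-δ 1 0 1 n a b) (mono-δ 2 0 1 n a b))
                                                            (mono-δ 2 1 1 n a b))
                                                (mono-δ 2 1 2 n a b)) ⟨
    numerator               ∎
    where
    numerator-δ : Series
    numerator-δ n a b = δℤ n 1 * δℤ a 0 * δℤ b 1 - δℤ n 2 * δℤ a 0 * δℤ b 1
                      + δℤ n 2 * δℤ a 1 * δℤ b 1 - δℤ n 2 * δℤ a 1 * δℤ b 2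
    -- by evaluation for n ≤ 2; for n ≥ 3 the two terms with a ≤ 1 cancel
    coefficient : ∀ n a b → NB n a b - Sh 1 0 1 NB n a b ≡ numerator-δ n a b
    coefficient zero a b = refl
    coefficient (suc zero)       zero          zero                = refl
    coefficient (suc zero)       zero          (suc zero)          = refl
    coefficient (suc zero)       zero          (suc (suc b))       = refl
    coefficient (suc zero)       (suc a)       zero                = refl
    coefficient (suc zero)       (suc a)       (suc b)             = refl
    coefficient (suc (suc zero)) zero          zero                = refl
    coefficient (suc (suc zero)) zero          (suc zero)          = refl
    coefficient (suc (suc zero)) zero          (suc (suc zero))    = refl
    coefficient (suc (suc zero)) zero          (suc (suc (suc b))) = refl
    coefficient (suc (suc zero)) (suc zero)    zero                = refl
    coefficient (suc (suc zero)) (suc zero)    (suc zero)          = refl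
    coefficient (suc (suc zero)) (suc zero)    (suc (suc zero))    = refl
    coefficient (suc (suc zero)) (suc zero)    (suc (suc (suc b))) = refl
    coefficient (suc (suc zero)) (suc (suc a)) zero                = refl
    coefficient (suc (suc zero)) (suc (suc a)) (suc b)             = refl
    coefficient (suc (suc (suc k))) zero          zero    = refl
    coefficient (suc (suc (suc k))) zero          (suc b) = ℤP.+-inverseʳ (δℤ (suc (suc k)) b - δℤ (suc k) b)
    coefficient (suc (suc (suc k))) (suc zero)    zero    = refl
    coefficient (suc (suc (suc k))) (suc zero)    (suc b) = ℤP.+-inverseʳ (δℤ (suc k) b - δℤ (suc (suc k)) b)
    coefficient (suc (suc (suc k))) (suc (suc a)) zero    = refl
    coefficient (suc (suc (suc k))) (suc (suc a)) (suc b) = refl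

open SeriesAlgebra using (≈-setoid; ⊛-congˡ)
open GeneratingFunction using (A; B; NB; numerator; ⊛-denominator; N⊛B≈NB; NB⊛A≈numerator; numerator≈)
open import Relation.Binary.Reasoning.Setoid ≈-setoid

proposition3p4 : ∀ n a b →
    (N ⊛ ((𝟙 ⊖ t ⊛ v) ⊛ (𝟙 ⊖ t ⊖ t ⊛ u ⊛ v))) n a b
      ≡ (t ⊛ v ⊛ (𝟙 ⊖ t ⊕ t ⊛ u ⊖ t ⊛ u ⊛ v)) n a b
proposition3p4 = begin
  N ⊛ (A ⊛ B)                           ≈⟨ ⊛-denominator N ⟩
  (N ⊛ B) ⊛ A                           ≈⟨ ⊛-congˡ A N⊛B≈NB ⟩
  NB ⊛ A                                ≈⟨ NB⊛A≈numerator ⟩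
  numerator                             ≈⟨ numerator≈ ⟨
  t ⊛ v ⊛ (𝟙 ⊖ t ⊕ t ⊛ u ⊖ t ⊛ u ⊛ v)   ∎
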